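{- Let $q$ be an odd prime power, fix $\epsilon\in\mathbb{F}_{q^2}\setminus\mathbb{F}_q$ with $\epsilon^q=-\epsilon$ and put $\delta=\epsilon^2\in\mathbb{F}_q$. Let $a=a_0+\epsilon a_1\in\mathbb{F}_{q^2}^*$ and $b=b_0+\epsilon b_1\in\mathbb{F}_{q^2}\setminus\mathbb{F}_q$ ($a_i,b_i\in\mathbb{F}_q$) with $4a^{q+1}+(b^q-b)^2\neq 0$, and let $\mathcal{B}_{a,b}$ be the surface of $\mathrm{PG}(3,q^2)$ with equation \[ Z^qJ^q-ZJ^{2q-1}+a^q(X^{2q}+Y^{2q})-a(X^2+Y^2)J^{2q-2}=(b^q-b)(X^{q+1}+Y^{q+1})J^{q-1}. \] Then, in the Barlotti--Cofman representation in $\mathrm{PG}(6,q)$, the affine points of $\mathcal{B}_{a,b}$ correspond to the affine points of the quadratic cone $\mathcal{B}'$ with equation \[ x_0x_6+2a_0(x_1x_2+x_3x_4)+a_1\big(x_1^2+x_3^2+\delta(x_2^2+x_4^2)\big)-b_1\big(x_1^2-\delta x_2^2+x_3^2-\delta x_4^2\big)=0, \] whose vertex is $V=(0,0,0,0,0,1,0)$ and whose base (the quadric of $\mathrm{PG}(5,q)$ in the coordinates $x_0,x_1,x_2,x_3,x_4,x_6$ given by the same equation) is a non-degenerate hyperbolic quadric. The Barlotti--Cofman representation of $\mathcal{B}_{a,b}$ is obtained by adjoining to these affine points the spread lines $r_P$ for $P\in\mathcal{B}_{a,b}\cap\{J=0\}$; these are $2q^2+1$ lines of the spread $\mathcal{S}$,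 and among them: if $q\equiv 1\pmod 4$, all $2q^2+1$ are contained in $\mathcal{B}'$; if $q\equiv 3\pmod 4$, exactly one is contained in $\mathcal{B}'$.
   Context: Points of $\mathrm{PG}(3,q^2)$ have homogeneous coordinates $(J,X,Y,Z)$, with plane at infinity $J=0$; points of $\mathrm{PG}(6,q)$ have homogeneous coordinates $(x_0,\dots,x_6)$, with hyperplane at infinity $x_0=0$. Every $c\in\mathbb{F}_{q^2}$ is written uniquely as $c=c_0+\epsilon c_1$ with $c_0,c_1\in\mathbb{F}_q$. Barlotti--Cofman (BC) representation: the affine point $(1,X,Y,Z)$ of $\mathrm{PG}(3,q^2)$ with $X=x_1+\epsilon x_2$, $Y=x_3+\epsilon x_4$, $Z=x_5+\epsilon x_6$ corresponds to the affine point $(1,x_1,\dots,x_6)$ of $\mathrm{PG}(6,q)$; a point $P=(0,u,v,w)$ at infinity corresponds to the spread line $r_P$ of the hyperplane $x_0=0$ consisting of the points $(0,u'_0,u'_1,v'_0,v'_1,w'_0,w'_1)$ with $(u',v',w')=(\lambda u,\lambda v,\lambda w)$, $\lambda\in\mathbb{F}_{q^2}^*$. The lines $r_P$ form a Desarguesian line spread $\mathcal{S}$ of $\{x_0=0\}$. The BC representation of a point set of $\mathrm{PG}(3,q^2)$ is the set of images of its affine points together with the union of the lines $r_P$ over its points $P$ at infinity. -}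

module Defs where

open import Data.Nat as ℕ using (ℕ; zero; suc)
open import Data.Nat.Primality using (Prime)
open import Data.Fin using (Fin)
open import Data.Fin.Patterns using (0F; 1F; 2F; 3F; 4F; 5F; 6F)
open import Data.Product using (Σ; _×_; _,_)
open import Data.List using (List; length)
open import Data.List.Relation.Unary.All using (All)
open import Data.List.Relation.Unary.Any using (Any)
open import Data.List.Relation.Unary.AllPairs using (AllPairs)
open import Relation.Nullary using (¬_)
open import Relation.Binary.PropositionalEquality using (_≡_)
open import Algebra.Structures using (IsCommutativeRing)
open import Function.Bundles using (_↔_)

IsOddPrimePower : ℕ → Set
IsOddPrimePower q =
  Σ ℕ λ p → Σ ℕ λ n → Prime p × 1 ℕ.≤ n × q ≡ p ℕ.^ n × q ℕ.% 2 ≡ 1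

record FiniteField : Set₁ where
  infixl 6 _+_
  infixl 7 _*_
  infix 8 -_
  field
    Carrier : Set
    _+_ _*_ : Carrier → Carrier → Carrier
    -_ : Carrier → Carrier
    0# 1# : Carrier
    isCommutativeRing : IsCommutativeRing _≡_ _+_ _*_ -_ 0# 1#
    0≢1 : ¬ (0# ≡ 1#)
    inverse : ∀ x → ¬ (x ≡ 0#) → Σ Carrier (λ y → x * y ≡ 1#)
    size : ℕ
    enumeration : Fin size ↔ Carrier

-- Everything below is relative to a fixed finite field F = F_{q^2}.

module FF (F : FiniteField) where
  open FiniteField F public

  infixl 6 _-_
  infixr 8 _^_

  _-_ : Carrier → Carrier → Carrier
  x - y = x + (- y)

  _^_ : Carrier → ℕ → Carrier
  x ^ zero = 1#
  x ^ suc n = x * (x ^ n)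

  2# 4# : Carrier
  2# = 1# + 1#
  4# = 2# + 2#

  InFq : ℕ → Carrier → Set
  InFq q x = x ^ q ≡ x

  -- vectors of F_q^n (coordinates of points of PG(n-1,q)), as functions
  Vecₙ : ℕ → Set
  Vecₙ n = Fin n → Carrier

  FqVec : ℕ → (n : ℕ) → Vecₙ n → Set
  FqVec q n x = ∀ i → InFq q (x i)

  _⊕_ : ∀ {n} → Vecₙ n → Vecₙ n → Vecₙ n
  (x ⊕ y) i = x i + y i

  _·_ : ∀ {n} → Carrier → Vecₙ n → Vecₙ n
  (c · x) i = c * x i

  IsZeroVec : ∀ {n} → Vecₙ n → Set
  IsZeroVec x = ∀ i → x i ≡ 0#

  SurfaceEq : (q : ℕ) (a b J X Y Z : Carrier) → Set
  SurfaceEq q a b J X Y Z =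
      (Z ^ q) * (J ^ q) - Z * (J ^ (2 ℕ.* q ℕ.∸ 1))
        + (a ^ q) * (X ^ (2 ℕ.* q) + Y ^ (2 ℕ.* q))
        - a * (X ^ 2 + Y ^ 2) * (J ^ (2 ℕ.* q ℕ.∸ 2))
    ≡ ((b ^ q) - b) * (X ^ (q ℕ.+ 1) + Y ^ (q ℕ.+ 1)) * (J ^ (q ℕ.∸ 1))

  Q′ : (δ a0 a1 b1 : Carrier) → Vecₙ 7 → Carrier
  Q′ δ a0 a1 b1 x =
      x 0F * x 6F
    + 2# * a0 * (x 1F * x 2F + x 3F * x 4F)
    + a1 * (x 1F ^ 2 + x 3F ^ 2 + δ * (x 2F ^ 2 + x 4F ^ 2))
    - b1 * (x 1F ^ 2 - δ * x 2F ^ 2 + x 3F ^ 2 - δ * x 4F ^ 2)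

  -- the base: the same equation on PG(5,q) in coordinates
  -- (x0,x1,x2,x3,x4,x6), i.e. with x5 removed
  embedBase : Vecₙ 6 → Vecₙ 7
  embedBase y 0F = y 0F
  embedBase y 1F = y 1F
  embedBase y 2F = y 2F
  embedBase y 3F = y 3F
  embedBase y 4F = y 4F
  embedBase y 5F = 0#
  embedBase y 6F = y 5F

  Qbase : (δ a0 a1 b1 : Carrier) → Vecₙ 6 → Carrier
  Qbase δ a0 a1 b1 y = Q′ δ a0 a1 b1 (embedBase y)

  V : Vecₙ 7
  V 5F = 1#
  V _  = 0#

  Polar : ∀ {n} → (Vecₙ n → Carrier) → Vecₙ n → Vecₙ n → Carrier
  Polar Q x y = Q (x ⊕ y) - Q x - Q y

  InRadical : ℕ → (n : ℕ) → (Vecₙ n → Carrier) → Vecₙ n → Set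
  InRadical q n Q x =
    Q x ≡ 0# × (∀ z → FqVec q n z → Polar Q x z ≡ 0#)

  NonDegenerate : ℕ → (n : ℕ) → (Vecₙ n → Carrier) → Set
  NonDegenerate q n Q =
    ∀ y → FqVec q n y → InRadical q n Q y → IsZeroVec y

  LinIndep3 : ℕ → (n : ℕ) → Vecₙ n → Vecₙ n → Vecₙ n → Set
  LinIndep3 q n u v w =
    ∀ l m k → InFq q l → InFq q m → InFq q k →
      IsZeroVec ((l · u) ⊕ ((m · v) ⊕ (k · w))) →
      l ≡ 0# × m ≡ 0# × k ≡ 0#

  -- non-degenerate hyperbolic quadric Q^+(5,q) of PG(5,q):
  -- non-degenerate of maximal Witt index 3, i.e. containing a plane
  HyperbolicPG5 : ℕ → (Vecₙ 6 → Carrier) → Set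
  HyperbolicPG5 q Q =
    NonDegenerate q 6 Q ×
    Σ (Vecₙ 6) λ u → Σ (Vecₙ 6) λ v → Σ (Vecₙ 6) λ w →
      FqVec q 6 u × FqVec q 6 v × FqVec q 6 w × LinIndep3 q 6 u v w ×
      (∀ l m k → InFq q l → InFq q m → InFq q k →
         Q ((l · u) ⊕ ((m · v) ⊕ (k · w))) ≡ 0#)

  -- Points at infinity of PG(3,q^2): (0,u,v,w), (u,v,w) ≠ 0, up to
  -- F_{q^2}^* scalars

  Triple : Set
  Triple = Carrier × Carrier × Carrier

  NonZeroTriple : Triple → Set
  NonZeroTriple (u , v , w) = ¬ (u ≡ 0# × v ≡ 0# × w ≡ 0#)

  Proportional : Triple → Triple → Set
  Proportional (u , v , w) (u′ , v′ , w′) =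
    Σ Carrier λ λ′ → ¬ (λ′ ≡ 0#) ×
      u′ ≡ λ′ * u × v′ ≡ λ′ * v × w′ ≡ λ′ * w

  AtInfinityOn : (q : ℕ) (a b : Carrier) → Triple → Set
  AtInfinityOn q a b (u , v , w) =
    NonZeroTriple (u , v , w) × SurfaceEq q a b 0# u v w

  -- the predicate P (on nonzero triples, invariant under scalars)
  -- holds for exactly k projective points
  ProjCount : (Triple → Set) → ℕ → Set
  ProjCount P k =
    Σ (List Triple) λ ps →
      length ps ≡ k × All P ps ×
      AllPairs (λ s t → ¬ Proportional s t) ps ×
      (∀ t → P t → Any (Proportional t) ps)

  Decomp : ℕ → (ε c c0 c1 : Carrier) → Set
  Decomp q ε c c0 c1 = InFq q c0 × InFq q c1 × c ≡ c0 + ε * c1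

  infPoint : Vecₙ 6 → Vecₙ 7
  infPoint c 0F = 0#
  infPoint c 1F = c 0F
  infPoint c 2F = c 1F
  infPoint c 3F = c 2F
  infPoint c 4F = c 3F
  infPoint c 5F = c 4F
  infPoint c 6F = c 5F

  -- the spread line r_P, P = (0,u,v,w), is contained in the quadric Q = 0:
  -- every point (0,u'0,u'1,v'0,v'1,w'0,w'1) with (u',v',w') = λ(u,v,w),
  -- λ ∈ F_{q^2}^*, lies on it
  SpreadLineIn : ℕ → (ε : Carrier) → (Vecₙ 7 → Carrier) → Triple → Set
  SpreadLineIn q ε Q (u , v , w) =
    ∀ l → ¬ (l ≡ 0#) → ∀ (c : Vecₙ 6) →
      Decomp q ε (l * u) (c 0F) (c 1F) →
      Decomp q ε (l * v) (c 2F) (c 3F) →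
      Decomp q ε (l * w) (c 4F) (c 5F) →
      Q (infPoint c) ≡ 0#

  affPoint : Vecₙ 6 → Vecₙ 7
  affPoint x 0F = 1#
  affPoint x 1F = x 0F
  affPoint x 2F = x 1F
  affPoint x 3F = x 2F
  affPoint x 4F = x 3F
  affPoint x 5F = x 4F
  affPoint x 6F = x 5F

{-# OPTIONS --safe #-}

-- With X = x₁ + εx₂, Y = x₃ + εx₄, Z = x₅ + εx₆ (xᵢ ∈ F_q), the q-th power acts as the conjugation
-- c₀ + εc₁ ↦ c₀ − εc₁, and at J = 1 the difference of the two sides of the equation of B_{a,b} is
-- −2ε · Q′(1, x₁, …, x₆); this gives the affine correspondence. The polar form of Q′ against the unit
-- vectors is built from x₀, x₆ and two 2 × 2 blocks of determinant −D, where 4D = 4a^{q+1} + (b^q − b)²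
-- ≠ 0; so the radical is spanned by V and the base is non-degenerate. A solution of x² − Dy² = −1 in
-- F_q, which exists because the (q+1)/2 squares and the (q+1)/2 values −1 + Dy² must meet, spans a
-- plane on the base. At J = 0 the equation becomes a^q (X² + Y²)^q = 0, i.e. X = ±iY with i² = −1,
-- which gives the point (0,0,1) and the 2q² points (±i, 1, z). On the spread line of such a point Q′
-- takes the value −b₁(U^{q+1} + V^{q+1}) at the point (U, V, W); for q ≡ 1 (mod 4) we have i ∈ F_q and
-- this vanishes, while for q ≡ 3 (mod 4) we have i ∈ εF_q and the point U = ±i, V = 1 gives −2b₁ ≠ 0.

module Submission where

open import Defs
open import Level using (0ℓ)
open import Data.Nat as ℕ using (ℕ; zero; suc; _∸_; _<_; z<s; s<s)
import Data.Nat.Properties as ℕ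
open import Data.Nat.DivMod using (_/_; _%_; m≡m%n+[m/n]*n)
open import Data.Nat.Divisibility using (_∣_; divides; ∣⇒≤)
open import Data.Nat.Primality using (Prime; euclidsLemma)
open import Data.Nat.Combinatorics using (_C_; nC1≡n; nCn≡1; nCk+nC[k+1]≡[n+1]C[k+1]; k>n⇒nCk≡0)
open import Data.Nat.Tactic.RingSolver using (solve-∀)
open import Data.Integer as ℤ using (ℤ)
import Data.Integer.Properties as ℤ
open import Data.Fin as Fin using (Fin; toℕ; inject₁; punchIn)
import Data.Fin.Properties as Fin
open import Data.Fin.Patterns using (0F; 1F; 2F; 3F; 4F; 5F; 6F)
open import Data.Fin.Permutation as Permutation using (Permutation; _⟨$⟩ʳ_)
open import Data.List using (List; []; _∷_; _++_; length; map; filter; tabulate)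
import Data.List.Properties as List
open import Data.List.Membership.Propositional using (_∈_; lose)
open import Data.List.Membership.Propositional.Properties
  using (∈-∃++; ∈-++⁻; ∈-++⁺ˡ; ∈-++⁺ʳ; ∈-map⁺; ∈-map⁻; ∈-tabulate⁺; ∈-filter⁺)
open import Data.List.Relation.Binary.Subset.Propositional using (_⊆_)
open import Data.List.Relation.Unary.Any using (Any; here; there; any?)
open import Data.List.Relation.Unary.All as All using (All; []; _∷_)
import Data.List.Relation.Unary.All.Properties as All
open import Data.List.Relation.Unary.AllPairs as AllPairs using (AllPairs; []; _∷_)
import Data.List.Relation.Unary.AllPairs.Properties as AllPairs
open import Data.List.Relation.Unary.Unique.Propositional using (Unique)
import Data.List.Relation.Unary.Unique.Propositional.Properties as Unique
open import Data.Maybe using (Maybe; just; nothing)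
open import Data.Product using (Σ; _×_; _,_; proj₁; proj₂)
open import Data.Sum using (_⊎_; inj₁; inj₂; [_,_]′)
open import Data.Empty using (⊥-elim)
open import Data.Vec.N-ary using (N-ary)
open import Function.Base using (_∘_)
open import Function.Bundles using (Inverse; Injection; _↔_; mk↔ₛ′)
open import Function.Properties.Inverse using (↔-sym; ↔-trans; Inverse⇒Injection)
open import Relation.Nullary using (¬_; yes; no; contradiction)
open import Relation.Nullary.Decidable using (via-injection; _×-dec_)
open import Relation.Binary.Definitions using (DecidableEquality; tri<; tri≈; tri>)
open import Relation.Binary.PropositionalEquality
open import Algebra.Bundles using (CommutativeRing; CommutativeMonoid)
open import Algebra.Structures using (IsCommutativeRing)
import Algebra.Properties.Ring as RingProperties
import Algebra.Properties.CommutativeMonoid.Sum as Sum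
import Algebra.Properties.CommutativeSemiring.Binomial as Binomial
import Algebra.Properties.Semiring.Exp as Exp
import Algebra.Properties.Semiring.Mult as Mult
import Algebra.Properties.Semiring.Mult.TCOptimised as Multiples
import Algebra.Solver.Ring.AlmostCommutativeRing as AlmostCommutativeRing
import Algebra.Solver.Ring as RingSolver

[1+k]*[1+n]C[1+k]≡[1+n]*nCk : ∀ n k → suc k ℕ.* (suc n C suc k) ≡ suc n ℕ.* (n C k)
[1+k]*[1+n]C[1+k]≡[1+n]*nCk zero zero = refl
[1+k]*[1+n]C[1+k]≡[1+n]*nCk zero (suc k) = begin
  suc (suc k) ℕ.* (1 C suc (suc k))   ≡⟨ cong (suc (suc k) ℕ.*_) (k>n⇒nCk≡0 {1} {suc (suc k)} (s<s z<s)) ⟩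
  suc (suc k) ℕ.* 0                   ≡⟨ ℕ.*-zeroʳ (suc (suc k)) ⟩
  0                                   ≡⟨ cong (1 ℕ.*_) (k>n⇒nCk≡0 {0} {suc k} z<s) ⟨
  1 ℕ.* (0 C suc k)                   ∎
  where open ≡-Reasoning
[1+k]*[1+n]C[1+k]≡[1+n]*nCk (suc n) zero = trans (ℕ.*-identityˡ _) (trans (nC1≡n (suc (suc n))) (sym (ℕ.*-identityʳ _)))
[1+k]*[1+n]C[1+k]≡[1+n]*nCk (suc n) (suc k) = begin
  suc (suc k) ℕ.* (suc (suc n) C suc (suc k))             ≡⟨ cong (suc (suc k) ℕ.*_) (nCk+nC[k+1]≡[n+1]C[k+1] (suc n) (suc k)) ⟨
  suc (suc k) ℕ.* (c₁ ℕ.+ c₂)                             ≡⟨ expand (suc k) c₁ c₂ ⟩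
  (suc k ℕ.* c₁ ℕ.+ c₁) ℕ.+ suc (suc k) ℕ.* c₂            ≡⟨ cong₂ (λ u v → (u ℕ.+ c₁) ℕ.+ v) ([1+k]*[1+n]C[1+k]≡[1+n]*nCk n k) ([1+k]*[1+n]C[1+k]≡[1+n]*nCk n (suc k)) ⟩
  (suc n ℕ.* (n C k) ℕ.+ c₁) ℕ.+ suc n ℕ.* (n C suc k)    ≡⟨ collect (suc n) (n C k) (n C suc k) c₁ ⟩
  suc n ℕ.* ((n C k) ℕ.+ (n C suc k)) ℕ.+ c₁              ≡⟨ cong (λ c → suc n ℕ.* c ℕ.+ c₁) (nCk+nC[k+1]≡[n+1]C[k+1] n k) ⟩
  suc n ℕ.* c₁ ℕ.+ c₁                                     ≡⟨ ℕ.+-comm (suc n ℕ.* c₁) c₁ ⟩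
  suc (suc n) ℕ.* c₁                                      ∎
  where
  open ≡-Reasoning
  c₁ c₂ : ℕ
  c₁ = suc n C suc k
  c₂ = suc n C suc (suc k)
  expand : ∀ k c₁ c₂ → suc k ℕ.* (c₁ ℕ.+ c₂) ≡ (k ℕ.* c₁ ℕ.+ c₁) ℕ.+ suc k ℕ.* c₂
  expand = solve-∀
  collect : ∀ m d₀ d₁ c → (m ℕ.* d₀ ℕ.+ c) ℕ.+ m ℕ.* d₁ ≡ m ℕ.* (d₀ ℕ.+ d₁) ℕ.+ c
  collect = solve-∀

p∣pCk : ∀ {p k} → Prime p → 0 < k → k < p → p ∣ p C k
p∣pCk {suc n} {suc k} p-prime _ k<p
  with euclidsLemma (suc k) (suc n C suc k) p-prime
         (divides (n C k) (trans ([1+k]*[1+n]C[1+k]≡[1+n]*nCk n k) (ℕ.*-comm (suc n) (n C k))))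
... | inj₁ p∣k = contradiction (∣⇒≤ p∣k) (ℕ.<⇒≱ k<p)
... | inj₂ p∣C = p∣C

Unique⇒length≤ : ∀ {A : Set} {xs ys : List A} → Unique xs → xs ⊆ ys → length xs ℕ.≤ length ys
Unique⇒length≤ {xs = []} _ _ = ℕ.z≤n
Unique⇒length≤ {xs = x ∷ xs} {ys} (x∉xs ∷ xs!) x∷xs⊆ys with us , vs , refl ← ∈-∃++ (x∷xs⊆ys (here refl)) =
  subst (length (x ∷ xs) ℕ.≤_) (sym length-us++x∷vs) (ℕ.s≤s (Unique⇒length≤ xs! xs⊆us++vs))
  where
  length-us++x∷vs : length (us ++ x ∷ vs) ≡ suc (length (us ++ vs))
  length-us++x∷vs = begin
    length (us ++ x ∷ vs)             ≡⟨ List.length-++ us ⟩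
    length us ℕ.+ suc (length vs)     ≡⟨ ℕ.+-suc (length us) (length vs) ⟩
    suc (length us ℕ.+ length vs)     ≡⟨ cong suc (List.length-++ us) ⟨
    suc (length (us ++ vs))           ∎
    where open ≡-Reasoning
  xs⊆us++vs : xs ⊆ us ++ vs
  xs⊆us++vs {z} z∈xs with ∈-++⁻ us (x∷xs⊆ys (there z∈xs))
  ... | inj₁ z∈us = ∈-++⁺ˡ z∈us
  ... | inj₂ (here z≡x) = ⊥-elim (All.lookup x∉xs z∈xs (sym z≡x))
  ... | inj₂ (there z∈vs) = ∈-++⁺ʳ us z∈vs

module _ (M : CommutativeMonoid 0ℓ 0ℓ) {A : Set} {n : ℕ} (e : Fin n ↔ A) where

  open CommutativeMonoid M using (Carrier; _≈_) renaming (trans to ≈-trans; reflexive to ≈-reflexive)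
  open Sum M using (sum; sum-permute; sum-cong-≗)
  open Inverse e using (to; from; strictlyInverseˡ)

  sum-reindex : (σ : A ↔ A) (f : A → Carrier) → sum (f ∘ to) ≈ sum (f ∘ Inverse.to σ ∘ to)
  sum-reindex σ f = ≈-trans (sum-permute (f ∘ to) (↔-trans e (↔-trans σ (↔-sym e))))
                          (≈-reflexive (sum-cong-≗ {n} (λ i → cong f (strictlyInverseˡ _))))

module FiniteFieldProperties (F : FiniteField) where

  open FF F public
  open IsCommutativeRing isCommutativeRing public
    using ( +-assoc; +-comm; +-identityˡ; +-identityʳ; -‿inverseˡ; -‿inverseʳ
          ; *-assoc; *-comm; *-identityˡ; *-identityʳ; distribʳ; zeroˡ; zeroʳ)
  open ≡-Reasoning

  commutativeRing : CommutativeRing 0ℓ 0ℓ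
  commutativeRing = record { isCommutativeRing = isCommutativeRing }

  open CommutativeRing commutativeRing public
    using (ring; semiring; +-commutativeMonoid; *-commutativeMonoid)
  open RingProperties ring public
    using ( -‿involutive; -‿injective; -‿distribˡ-*; -‿distribʳ-*; -0#≈0#
          ; -‿anti-homo-+; +-cancelˡ; +-identityʳ-unique; +-inverseʳ-unique; x∙y⁻¹≈ε⇒x≈y; x≈y⇒x∙y⁻¹≈ε)

  infix 4 _≟_
  _≟_ : DecidableEquality Carrier
  _≟_ = via-injection (Inverse⇒Injection (↔-sym enumeration)) Fin._≟_

  elements : List Carrier
  elements = tabulate (Inverse.to enumeration)

  ∈-elements : ∀ x → x ∈ elements
  ∈-elements x = subst (_∈ elements) (Inverse.strictlyInverseˡ enumeration x) (∈-tabulate⁺ (Inverse.from enumeration x))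

  elements-unique : Unique elements
  elements-unique = Unique.tabulate⁺ (Injection.injective (Inverse⇒Injection enumeration))

  length-elements : length elements ≡ size
  length-elements = List.length-tabulate (Inverse.to enumeration)

  -- With the type-checking-optimised multiple, fromℕ 1 and fromℕ 2 reduce to 1# and 2#, so that the
  -- solver constants con (ℤ.+ 1) and con (ℤ.+ 2) denote 1# and 2#.
  fromℕ : ℕ → Carrier
  fromℕ n = n ×′ 1#
    where open Multiples semiring using () renaming (_×_ to _×′_)

  fromℕ-+ : ∀ m n → fromℕ (m ℕ.+ n) ≡ fromℕ m + fromℕ n
  fromℕ-+ m n = Multiples.×-homo-+ semiring 1# m n

  fromℕ-* : ∀ m n → fromℕ (m ℕ.* n) ≡ fromℕ m * fromℕ n
  fromℕ-* = Multiples.×1-homo-* semiring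

  fromℕ-suc : ∀ n → fromℕ (suc n) ≡ 1# + fromℕ n
  fromℕ-suc n = fromℕ-+ 1 n

  fromℤ : ℤ → Carrier
  fromℤ (ℤ.+ n) = fromℕ n
  fromℤ ℤ.-[1+ n ] = - fromℕ (suc n)

  x+y-[x+z]≡y-z : ∀ x y z → (x + y) - (x + z) ≡ y - z
  x+y-[x+z]≡y-z x y z = begin
    (x + y) + - (x + z)    ≡⟨ cong ((x + y) +_) (-‿anti-homo-+ x z) ⟩
    (x + y) + (- z + - x)  ≡⟨ +-assoc x y _ ⟩
    x + (y + (- z + - x))  ≡⟨ cong (x +_) (+-assoc y (- z) (- x)) ⟨
    x + ((y - z) + - x)    ≡⟨ cong (x +_) (+-comm (y - z) (- x)) ⟩
    x + (- x + (y - z))    ≡⟨ +-assoc x (- x) _ ⟨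
    (x - x) + (y - z)      ≡⟨ cong (_+ (y - z)) (-‿inverseʳ x) ⟩
    0# + (y - z)           ≡⟨ +-identityˡ _ ⟩
    y - z                  ∎

  fromℤ-⊖ : ∀ m n → fromℤ (m ℤ.⊖ n) ≡ fromℕ m - fromℕ n
  fromℤ-⊖ m zero = sym (trans (cong (fromℕ m +_) -0#≈0#) (+-identityʳ _))
  fromℤ-⊖ zero (suc n) = sym (+-identityˡ _)
  fromℤ-⊖ (suc m) (suc n) = begin
    fromℤ (suc m ℤ.⊖ suc n)            ≡⟨ cong fromℤ (ℤ.[1+m]⊖[1+n]≡m⊖n m n) ⟩
    fromℤ (m ℤ.⊖ n)                    ≡⟨ fromℤ-⊖ m n ⟩
    fromℕ m - fromℕ n                  ≡⟨ x+y-[x+z]≡y-z 1# (fromℕ m) (fromℕ n) ⟨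
    (1# + fromℕ m) - (1# + fromℕ n)    ≡⟨ cong₂ _-_ (fromℕ-suc m) (fromℕ-suc n) ⟨
    fromℕ (suc m) - fromℕ (suc n)      ∎

  fromℤ-+ : ∀ i j → fromℤ (i ℤ.+ j) ≡ fromℤ i + fromℤ j
  fromℤ-+ (ℤ.+ m) (ℤ.+ n) = fromℕ-+ m n
  fromℤ-+ (ℤ.+ m) ℤ.-[1+ n ] = fromℤ-⊖ m (suc n)
  fromℤ-+ ℤ.-[1+ m ] (ℤ.+ n) = trans (fromℤ-⊖ n (suc m)) (+-comm _ _)
  fromℤ-+ ℤ.-[1+ m ] ℤ.-[1+ n ] = begin
    - fromℕ (suc (suc (m ℕ.+ n)))            ≡⟨ cong (λ k → - fromℕ (suc k)) (ℕ.+-suc m n) ⟨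
    - fromℕ (suc m ℕ.+ suc n)                ≡⟨ cong -_ (fromℕ-+ (suc m) (suc n)) ⟩
    - (fromℕ (suc m) + fromℕ (suc n))        ≡⟨ -‿anti-homo-+ _ _ ⟩
    - fromℕ (suc n) + - fromℕ (suc m)        ≡⟨ +-comm _ _ ⟩
    - fromℕ (suc m) + - fromℕ (suc n)        ∎

  fromℤ-neg : ∀ i → fromℤ (ℤ.- i) ≡ - fromℤ i
  fromℤ-neg (ℤ.+ zero) = sym -0#≈0#
  fromℤ-neg (ℤ.+ suc n) = refl
  fromℤ-neg ℤ.-[1+ n ] = sym (-‿involutive _)

  fromℤ-*-pos : ∀ i n → fromℤ (i ℤ.* ℤ.+ n) ≡ fromℤ i * fromℕ n
  fromℤ-*-pos (ℤ.+ m) n = trans (cong fromℤ (sym (ℤ.pos-* m n))) (fromℕ-* m n)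
  fromℤ-*-pos ℤ.-[1+ m ] n = begin
    fromℤ (ℤ.-[1+ m ] ℤ.* ℤ.+ n)          ≡⟨ cong fromℤ (ℤ.neg-distribˡ-* (ℤ.+ suc m) (ℤ.+ n)) ⟨
    fromℤ (ℤ.- (ℤ.+ suc m ℤ.* ℤ.+ n))     ≡⟨ fromℤ-neg (ℤ.+ suc m ℤ.* ℤ.+ n) ⟩
    - fromℤ (ℤ.+ suc m ℤ.* ℤ.+ n)         ≡⟨ cong -_ (fromℤ-*-pos (ℤ.+ suc m) n) ⟩
    - (fromℕ (suc m) * fromℕ n)           ≡⟨ -‿distribˡ-* _ _ ⟩
    - fromℕ (suc m) * fromℕ n             ∎

  fromℤ-* : ∀ i j → fromℤ (i ℤ.* j) ≡ fromℤ i * fromℤ j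
  fromℤ-* i (ℤ.+ n) = fromℤ-*-pos i n
  fromℤ-* i ℤ.-[1+ n ] = begin
    fromℤ (i ℤ.* ℤ.-[1+ n ])            ≡⟨ cong fromℤ (ℤ.neg-distribʳ-* i (ℤ.+ suc n)) ⟨
    fromℤ (ℤ.- (i ℤ.* ℤ.+ suc n))       ≡⟨ fromℤ-neg (i ℤ.* ℤ.+ suc n) ⟩
    - fromℤ (i ℤ.* ℤ.+ suc n)           ≡⟨ cong -_ (fromℤ-*-pos i (suc n)) ⟩
    - (fromℤ i * fromℕ (suc n))         ≡⟨ -‿distribʳ-* _ _ ⟩
    fromℤ i * - fromℕ (suc n)           ∎

  fromℤ-morphism : ℤ.+-*-rawRing AlmostCommutativeRing.-Raw-AlmostCommutative⟶
                     AlmostCommutativeRing.fromCommutativeRing commutativeRing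
  fromℤ-morphism = record
    { ⟦_⟧ = fromℤ ; +-homo = fromℤ-+ ; *-homo = fromℤ-* ; -‿homo = fromℤ-neg
    ; 0-homo = refl ; 1-homo = refl }

  fromℤ-≟ : ∀ i j → Maybe (fromℤ i ≡ fromℤ j)
  fromℤ-≟ i j with i ℤ.≟ j
  ... | yes i≡j = just (cong fromℤ i≡j)
  ... | no _ = nothing

  open RingSolver ℤ.+-*-rawRing (AlmostCommutativeRing.fromCommutativeRing commutativeRing)
                  fromℤ-morphism fromℤ-≟ public
    using (Polynomial; solve; _:=_; con; _:+_; _:*_; :-_; _:-_; _:^_)

  _⁻¹ : Carrier → Carrier
  x ⁻¹ with x ≟ 0#
  ... | yes _ = 0#
  ... | no x≢0 = proj₁ (inverse x x≢0)

  x*x⁻¹≡1 : ∀ {x} → x ≢ 0# → x * x ⁻¹ ≡ 1#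
  x*x⁻¹≡1 {x} x≢0 with x ≟ 0#
  ... | yes x≡0 = ⊥-elim (x≢0 x≡0)
  ... | no x≢0′ = proj₂ (inverse x x≢0′)

  x⁻¹*x≡1 : ∀ {x} → x ≢ 0# → x ⁻¹ * x ≡ 1#
  x⁻¹*x≡1 {x} x≢0 = trans (*-comm (x ⁻¹) x) (x*x⁻¹≡1 x≢0)

  *-cancelˡ : ∀ {x y z} → x ≢ 0# → x * y ≡ x * z → y ≡ z
  *-cancelˡ {x} {y} {z} x≢0 xy≡xz = begin
    y                  ≡⟨ *-identityˡ y ⟨
    1# * y             ≡⟨ cong (_* y) (x⁻¹*x≡1 x≢0) ⟨
    (x ⁻¹ * x) * y     ≡⟨ *-assoc (x ⁻¹) x y ⟩
    x ⁻¹ * (x * y)     ≡⟨ cong (x ⁻¹ *_) xy≡xz ⟩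
    x ⁻¹ * (x * z)     ≡⟨ *-assoc (x ⁻¹) x z ⟨
    (x ⁻¹ * x) * z     ≡⟨ cong (_* z) (x⁻¹*x≡1 x≢0) ⟩
    1# * z             ≡⟨ *-identityˡ z ⟩
    z                  ∎

  x*y≡0⇒x≡0⊎y≡0 : ∀ {x y} → x * y ≡ 0# → x ≡ 0# ⊎ y ≡ 0#
  x*y≡0⇒x≡0⊎y≡0 {x} {y} xy≡0 with x ≟ 0#
  ... | yes x≡0 = inj₁ x≡0
  ... | no x≢0 = inj₂ (*-cancelˡ x≢0 (trans xy≡0 (sym (zeroʳ x))))

  x≢0∧y≢0⇒x*y≢0 : ∀ {x y} → x ≢ 0# → y ≢ 0# → x * y ≢ 0#
  x≢0∧y≢0⇒x*y≢0 x≢0 y≢0 xy≡0 with x*y≡0⇒x≡0⊎y≡0 xy≡0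
  ... | inj₁ x≡0 = x≢0 x≡0
  ... | inj₂ y≡0 = y≢0 y≡0

  x≢0⇒x⁻¹≢0 : ∀ {x} → x ≢ 0# → x ⁻¹ ≢ 0#
  x≢0⇒x⁻¹≢0 {x} x≢0 x⁻¹≡0 = 0≢1 (begin
    0#            ≡⟨ zeroʳ x ⟨
    x * 0#        ≡⟨ cong (x *_) x⁻¹≡0 ⟨
    x * x ⁻¹      ≡⟨ x*x⁻¹≡1 x≢0 ⟩
    1#            ∎)

  -x≡0⇒x≡0 : ∀ {x} → - x ≡ 0# → x ≡ 0#
  -x≡0⇒x≡0 -x≡0 = -‿injective (trans -x≡0 (sym -0#≈0#))

  ^-homo-* : ∀ x m n → x ^ (m ℕ.+ n) ≡ x ^ m * x ^ n
  ^-homo-* x zero n = sym (*-identityˡ _)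
  ^-homo-* x (suc m) n = trans (cong (x *_) (^-homo-* x m n)) (sym (*-assoc _ _ _))

  ^-distrib-* : ∀ x y n → (x * y) ^ n ≡ x ^ n * y ^ n
  ^-distrib-* x y zero = sym (*-identityˡ 1#)
  ^-distrib-* x y (suc n) =
    trans (cong ((x * y) *_) (^-distrib-* x y n))
          (solve 4 (λ x y u v → (x :* y) :* (u :* v) := (x :* u) :* (y :* v)) refl x y (x ^ n) (y ^ n))

  1^n≡1 : ∀ n → 1# ^ n ≡ 1#
  1^n≡1 zero = refl
  1^n≡1 (suc n) = trans (*-identityˡ _) (1^n≡1 n)

  ^-assocʳ : ∀ x m n → (x ^ m) ^ n ≡ x ^ (m ℕ.* n)
  ^-assocʳ x zero n = 1^n≡1 n
  ^-assocʳ x (suc m) n = begin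
    (x * x ^ m) ^ n          ≡⟨ ^-distrib-* x (x ^ m) n ⟩
    x ^ n * (x ^ m) ^ n      ≡⟨ cong (x ^ n *_) (^-assocʳ x m n) ⟩
    x ^ n * x ^ (m ℕ.* n)    ≡⟨ ^-homo-* x n (m ℕ.* n) ⟨
    x ^ (n ℕ.+ m ℕ.* n)      ∎

  x≢0⇒x^n≢0 : ∀ {x} n → x ≢ 0# → x ^ n ≢ 0#
  x≢0⇒x^n≢0 zero x≢0 1≡0 = 0≢1 (sym 1≡0)
  x≢0⇒x^n≢0 (suc n) x≢0 = x≢0∧y≢0⇒x*y≢0 x≢0 (x≢0⇒x^n≢0 n x≢0)

  x^n≡0⇒x≡0 : ∀ {x} n → x ^ n ≡ 0# → x ≡ 0#
  x^n≡0⇒x≡0 {x} n xⁿ≡0 with x ≟ 0#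
  ... | yes x≡0 = x≡0
  ... | no x≢0 = ⊥-elim (x≢0⇒x^n≢0 n x≢0 xⁿ≡0)

  fromℕ-^ : ∀ m k → fromℕ (m ℕ.^ k) ≡ fromℕ m ^ k
  fromℕ-^ m zero = refl
  fromℕ-^ m (suc k) = trans (fromℕ-* m (m ℕ.^ k)) (cong (fromℕ m *_) (fromℕ-^ m k))

  0^n≡0 : ∀ {n} → 1 ℕ.≤ n → 0# ^ n ≡ 0#
  0^n≡0 {suc n} _ = zeroˡ _

  x*y≡1⇒y≡x⁻¹ : ∀ {x y} → x * y ≡ 1# → y ≡ x ⁻¹
  x*y≡1⇒y≡x⁻¹ {x} {y} xy≡1 = *-cancelˡ x≢0 (trans xy≡1 (sym (x*x⁻¹≡1 x≢0)))
    where
    x≢0 : x ≢ 0#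
    x≢0 x≡0 = 0≢1 (trans (sym (zeroˡ y)) (trans (cong (_* y) (sym x≡0)) xy≡1))

  -‿⁻¹ : ∀ {x} → x ≢ 0# → (- x) ⁻¹ ≡ - (x ⁻¹)
  -‿⁻¹ {x} x≢0 = sym (x*y≡1⇒y≡x⁻¹ (trans (solve 2 (λ x y → (:- x) :* (:- y) := x :* y) refl x (x ⁻¹)) (x*x⁻¹≡1 x≢0)))

  x*x≡y*y⇒x≡±y : ∀ {x y} → x * x ≡ y * y → x ≡ y ⊎ x ≡ - y
  x*x≡y*y⇒x≡±y {x} {y} x²≡y² with x*y≡0⇒x≡0⊎y≡0 [x-y][x+y]≡0
    where
    [x-y][x+y]≡0 : (x - y) * (x + y) ≡ 0#
    [x-y][x+y]≡0 = begin
      (x - y) * (x + y)   ≡⟨ solve 2 (λ x y → (x :- y) :* (x :+ y) := x :* x :- y :* y) refl x y ⟩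
      x * x - y * y       ≡⟨ x≈y⇒x∙y⁻¹≈ε x²≡y² ⟩
      0#                  ∎
  ... | inj₁ x-y≡0 = inj₁ (x∙y⁻¹≈ε⇒x≈y x y x-y≡0)
  ... | inj₂ x+y≡0 = inj₂ (+-inverseʳ-unique y x (trans (+-comm y x) x+y≡0))

  u*u+v*v≡0⇒v≡0⇒u≡0 : ∀ {u v} → u * u + v * v ≡ 0# → v ≡ 0# → u ≡ 0#
  u*u+v*v≡0⇒v≡0⇒u≡0 {u} {v} u²+v²≡0 v≡0 with x*y≡0⇒x≡0⊎y≡0 u*u≡0
    where
    u*u≡0 : u * u ≡ 0#
    u*u≡0 = trans (sym (trans (cong (λ z → u * u + z * z) v≡0) (trans (cong (u * u +_) (zeroˡ 0#)) (+-identityʳ _)))) u²+v²≡0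
  ... | inj₁ u≡0 = u≡0
  ... | inj₂ u≡0 = u≡0

  u*u+v*v≡0⇒[u/v]²≡-1 : ∀ {u v} → v ≢ 0# → u * u + v * v ≡ 0# → (v ⁻¹ * u) * (v ⁻¹ * u) ≡ - 1#
  u*u+v*v≡0⇒[u/v]²≡-1 {u} {v} v≢0 u²+v²≡0 = begin
    (v ⁻¹ * u) * (v ⁻¹ * u)                                  ≡⟨ solve 3 (λ l u v → (l :* u) :* (l :* u) := (l :* l) :* (u :* u :+ v :* v) :- (l :* v) :* (l :* v)) refl (v ⁻¹) u v ⟩
    (v ⁻¹ * v ⁻¹) * (u * u + v * v) - (v ⁻¹ * v) * (v ⁻¹ * v)  ≡⟨ cong₂ (λ s t → (v ⁻¹ * v ⁻¹) * s - t * t) u²+v²≡0 (x⁻¹*x≡1 v≢0) ⟩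
    (v ⁻¹ * v ⁻¹) * 0# - 1# * 1#                             ≡⟨ solve 1 (λ l → l :* con (ℤ.+ 0) :- con (ℤ.+ 1) :* con (ℤ.+ 1) := :- con (ℤ.+ 1)) refl (v ⁻¹ * v ⁻¹) ⟩
    - 1#                                                     ∎

  isotropic-scaled : ∀ {u v} l → u * u + v * v ≡ 0# → (l * u) * (l * u) + (l * v) * (l * v) ≡ 0#
  isotropic-scaled {u} {v} l u²+v²≡0 = begin
    (l * u) * (l * u) + (l * v) * (l * v)  ≡⟨ solve 3 (λ l u v → (l :* u) :* (l :* u) :+ (l :* v) :* (l :* v) := (l :* l) :* (u :* u :+ v :* v)) refl l u v ⟩
    (l * l) * (u * u + v * v)              ≡⟨ cong ((l * l) *_) u²+v²≡0 ⟩
    (l * l) * 0#                           ≡⟨ zeroʳ _ ⟩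
    0#                                     ∎

  private
    module ∑ = Sum +-commutativeMonoid
    module ∏ = Sum *-commutativeMonoid

  translation : Carrier → Carrier ↔ Carrier
  translation c = mk↔ₛ′ (_+ c) (_- c)
    (λ y → solve 2 (λ y c → y :- c :+ c := y) refl y c)
    (λ y → solve 2 (λ y c → y :+ c :- c := y) refl y c)

  -- Translation by 1 permutes the elements, so their sum is unchanged by adding 1 to each of them.
  fromℕ-size≡0 : fromℕ size ≡ 0#
  fromℕ-size≡0 = +-identityʳ-unique (∑.sum to) (fromℕ size) (begin
    ∑.sum to + fromℕ size                 ≡⟨ cong (∑.sum to +_) (Multiples.×ᵤ≈× semiring size 1#) ⟨
    ∑.sum to + _                          ≡⟨ cong (∑.sum to +_) (∑.sum-replicate size) ⟨
    ∑.sum to + ∑.sum {size} (λ _ → 1#)    ≡⟨ ∑.∑-distrib-+ to (λ _ → 1#) ⟨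
    ∑.sum (λ i → to i + 1#)               ≡⟨ sum-reindex +-commutativeMonoid enumeration (translation 1#) (λ y → y) ⟨
    ∑.sum to                              ∎)
    where
    to : Fin size → Carrier
    to = Inverse.to enumeration

  ∏-scale : ∀ {n} x (f : Fin n → Carrier) → ∏.sum (λ i → x * f i) ≡ x ^ n * ∏.sum f
  ∏-scale {zero} x f = sym (*-identityˡ 1#)
  ∏-scale {suc n} x f = begin
    (x * f Fin.zero) * ∏.sum (λ i → x * f (Fin.suc i))        ≡⟨ cong ((x * f Fin.zero) *_) (∏-scale x (f ∘ Fin.suc)) ⟩
    (x * f Fin.zero) * (x ^ n * ∏.sum (f ∘ Fin.suc))          ≡⟨ solve 4 (λ x y u v → (x :* y) :* (u :* v) := (x :* u) :* (y :* v)) refl x _ _ _ ⟩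
    (x * x ^ n) * (f Fin.zero * ∏.sum (f ∘ Fin.suc))          ∎

  ∏-≢0 : ∀ {n} (f : Fin n → Carrier) → (∀ i → f i ≢ 0#) → ∏.sum f ≢ 0#
  ∏-≢0 {zero} f _ 1≡0 = 0≢1 (sym 1≡0)
  ∏-≢0 {suc n} f f≢0 = x≢0∧y≢0⇒x*y≢0 (f≢0 Fin.zero) (∏-≢0 (f ∘ Fin.suc) (f≢0 ∘ Fin.suc))

  scaling : ∀ {x} → x ≢ 0# → Carrier ↔ Carrier
  scaling {x} x≢0 = mk↔ₛ′ (x *_) (x ⁻¹ *_)
    (λ y → trans (sym (*-assoc x (x ⁻¹) y)) (trans (cong (_* y) (x*x⁻¹≡1 x≢0)) (*-identityˡ y)))
    (λ y → trans (sym (*-assoc (x ⁻¹) x y)) (trans (cong (_* y) (x⁻¹*x≡1 x≢0)) (*-identityˡ y)))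

  -- Multiplication by x permutes the nonzero elements, whose product is therefore multiplied by x ^ m.
  x^m≡1 : ∀ {m} (e : Fin (suc m) ↔ Carrier) {x} → x ≢ 0# → x ^ m ≡ 1#
  x^m≡1 {m} e {x} x≢0 = *-cancelˡ (∏-≢0 nonzero nonzero≢0) (begin
    ∏.sum nonzero * x ^ m                ≡⟨ *-comm _ _ ⟩
    x ^ m * ∏.sum nonzero                ≡⟨ ∏-scale x nonzero ⟨
    ∏.sum (λ j → x * nonzero j)          ≡⟨ ∏.sum-cong-≗ nonzero∘σ ⟨
    ∏.sum (nonzero ∘ (σ ⟨$⟩ʳ_))          ≡⟨ ∏.sum-permute nonzero σ ⟨
    ∏.sum nonzero                        ≡⟨ *-identityʳ _ ⟨
    ∏.sum nonzero * 1#                   ∎)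
    where
    open Inverse e using () renaming (to to elem; from to index; strictlyInverseˡ to elem∘index; strictlyInverseʳ to index∘elem)
    π : Permutation (suc m) (suc m)
    π = ↔-trans e (↔-trans (scaling x≢0) (↔-sym e))
    z : Fin (suc m)
    z = index 0#
    πz≡z : π ⟨$⟩ʳ z ≡ z
    πz≡z = cong index (trans (cong (x *_) (elem∘index 0#)) (zeroʳ x))
    σ : Permutation m m
    σ = Permutation.remove z π
    nonzero : Fin m → Carrier
    nonzero j = elem (punchIn z j)
    nonzero≢0 : ∀ j → nonzero j ≢ 0#
    nonzero≢0 j e≡0 = Fin.punchInᵢ≢i z j (trans (sym (index∘elem _)) (cong index e≡0))
    nonzero∘σ : ∀ j → nonzero (σ ⟨$⟩ʳ j) ≡ x * nonzero j
    nonzero∘σ j = begin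
      elem (punchIn z (σ ⟨$⟩ʳ j))             ≡⟨ cong (λ w → elem (punchIn w (σ ⟨$⟩ʳ j))) πz≡z ⟨
      elem (punchIn (π ⟨$⟩ʳ z) (σ ⟨$⟩ʳ j))    ≡⟨ cong elem (Permutation.punchIn-permute π z j) ⟨
      elem (π ⟨$⟩ʳ punchIn z j)               ≡⟨ elem∘index _ ⟩
      x * nonzero j                           ∎

  x^size≡x : ∀ x → x ^ size ≡ x
  x^size≡x x with size | enumeration
  ... | zero | e = ⊥-elim (Fin.¬Fin0 (Inverse.from e 0#))
  ... | suc m | e with x ≟ 0#
  ...   | yes x≡0 = trans (cong (_^ suc m) x≡0) (trans (zeroˡ _) (sym x≡0))
  ...   | no x≢0 = trans (cong (x *_) (x^m≡1 e x≢0)) (*-identityʳ x)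

  private
    module B = Binomial (CommutativeRing.commutativeSemiring commutativeRing)
    module E = Exp semiring
    module M = Mult semiring

    ^≡^ᴱ : ∀ x n → x ^ n ≡ x E.^ n
    ^≡^ᴱ x zero = refl
    ^≡^ᴱ x (suc n) = cong (x *_) (^≡^ᴱ x n)

    ×≡fromℕ* : ∀ n z → n M.× z ≡ fromℕ n * z
    ×≡fromℕ* n z = begin
      n M.× z              ≡⟨ cong (n M.×_) (*-identityˡ z) ⟨
      n M.× (1# * z)       ≡⟨ M.×-assoc-* n 1# z ⟨
      (n M.× 1#) * z       ≡⟨ cong (_* z) (Multiples.×ᵤ≈× semiring n 1#) ⟩
      fromℕ n * z          ∎

  private module _ {m : ℕ} (p-prime : Prime (suc m)) (p≡0 : fromℕ (suc m) ≡ 0#) (x y : Carrier) where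

    private
      p : ℕ
      p = suc m
      term : Fin (suc p) → Carrier
      term = B.binomialTerm x y p

    term-first : term Fin.zero ≡ y ^ p
    term-first = trans (+-identityʳ _) (trans (*-identityˡ _) (sym (^≡^ᴱ y p)))

    term-middle : ∀ j → term (Fin.suc (inject₁ j)) ≡ 0#
    term-middle j with p∣pCk p-prime z<s (s<s (subst (_< m) (sym (Fin.toℕ-inject₁ j)) (Fin.toℕ<n j)))
    ... | divides c p∣C = begin
      (p C suc (toℕ (inject₁ j))) M.× b    ≡⟨ ×≡fromℕ* (p C suc (toℕ (inject₁ j))) b ⟩
      fromℕ (p C suc (toℕ (inject₁ j))) * b ≡⟨ cong (λ n → fromℕ n * b) p∣C ⟩
      fromℕ (c ℕ.* p) * b                  ≡⟨ cong (_* b) (fromℕ-* c p) ⟩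
      (fromℕ c * fromℕ p) * b              ≡⟨ cong (λ z → (fromℕ c * z) * b) p≡0 ⟩
      (fromℕ c * 0#) * b                   ≡⟨ cong (_* b) (zeroʳ (fromℕ c)) ⟩
      0# * b                               ≡⟨ zeroˡ b ⟩
      0#                                   ∎
      where
      b : Carrier
      b = B.binomial x y p (Fin.suc (inject₁ j))

    term-last : term (Fin.suc (Fin.fromℕ m)) ≡ x ^ p
    term-last rewrite Fin.toℕ-fromℕ m | nCn≡1 p | ℕ.n∸n≡0 m =
      trans (+-identityʳ _) (trans (*-identityʳ _) (sym (^≡^ᴱ x p)))

    ^p-+ : (x + y) ^ p ≡ x ^ p + y ^ p
    ^p-+ = begin
      (x + y) ^ p                                        ≡⟨ ^≡^ᴱ (x + y) p ⟩
      (x + y) E.^ p                                      ≡⟨ B.theorem p x y ⟩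
      term Fin.zero + ∑.sum (term ∘ Fin.suc)             ≡⟨ cong (term Fin.zero +_) (∑.sum-init-last (term ∘ Fin.suc)) ⟩
      term Fin.zero + (∑.sum (term ∘ Fin.suc ∘ inject₁) + term (Fin.suc (Fin.fromℕ m)))
                                                         ≡⟨ cong₂ (λ u v → term Fin.zero + (u + v)) middle≡0 term-last ⟩
      term Fin.zero + (0# + x ^ p)                       ≡⟨ cong₂ _+_ term-first (+-identityˡ _) ⟩
      y ^ p + x ^ p                                      ≡⟨ +-comm _ _ ⟩
      x ^ p + y ^ p                                      ∎
      where
      middle≡0 : ∑.sum (term ∘ Fin.suc ∘ inject₁) ≡ 0#
      middle≡0 = trans (∑.sum-cong-≗ term-middle) (∑.sum-replicate-zero m)

  ^pⁿ-+ : ∀ {p} → Prime p → fromℕ p ≡ 0# → ∀ n x y → (x + y) ^ (p ℕ.^ n) ≡ x ^ (p ℕ.^ n) + y ^ (p ℕ.^ n)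
  ^pⁿ-+ _ _ zero x y = distribʳ 1# x y
  ^pⁿ-+ {p@(suc _)} p-prime p≡0 (suc n) x y = begin
    (x + y) ^ (p ℕ.* p ℕ.^ n)                   ≡⟨ ^-assocʳ (x + y) p (p ℕ.^ n) ⟨
    ((x + y) ^ p) ^ (p ℕ.^ n)                   ≡⟨ cong (_^ (p ℕ.^ n)) (^p-+ p-prime p≡0 x y) ⟩
    (x ^ p + y ^ p) ^ (p ℕ.^ n)                 ≡⟨ ^pⁿ-+ p-prime p≡0 n (x ^ p) (y ^ p) ⟩
    (x ^ p) ^ (p ℕ.^ n) + (y ^ p) ^ (p ℕ.^ n)   ≡⟨ cong₂ _+_ (^-assocʳ x p (p ℕ.^ n)) (^-assocʳ y p (p ℕ.^ n)) ⟩
    x ^ (p ℕ.* p ℕ.^ n) + y ^ (p ℕ.* p ℕ.^ n)   ∎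

module Subfield {q p n : ℕ} (p-prime : Prime p) (1≤n : 1 ℕ.≤ n) (q≡pⁿ : q ≡ p ℕ.^ n) (q%2≡1 : q % 2 ≡ 1)
                (F : FiniteField) (|F|≡q² : FiniteField.size F ≡ q ℕ.^ 2) where

  open FiniteFieldProperties F public
  open ≡-Reasoning

  h : ℕ
  h = q / 2

  q≡1+h*2 : q ≡ 1 ℕ.+ h ℕ.* 2
  q≡1+h*2 = trans (m≡m%n+[m/n]*n q 2) (cong (ℕ._+ h ℕ.* 2) q%2≡1)

  fromℕ-p≡0 : fromℕ p ≡ 0#
  fromℕ-p≡0 = x^n≡0⇒x≡0 (n ℕ.* 2) (begin
    fromℕ p ^ (n ℕ.* 2)       ≡⟨ fromℕ-^ p (n ℕ.* 2) ⟨
    fromℕ (p ℕ.^ (n ℕ.* 2))   ≡⟨ cong fromℕ (ℕ.^-*-assoc p n 2) ⟨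
    fromℕ ((p ℕ.^ n) ℕ.^ 2)   ≡⟨ cong (λ m → fromℕ (m ℕ.^ 2)) q≡pⁿ ⟨
    fromℕ (q ℕ.^ 2)           ≡⟨ cong fromℕ |F|≡q² ⟨
    fromℕ size                ≡⟨ fromℕ-size≡0 ⟩
    0#                        ∎)

  fromℕ-q≡0 : fromℕ q ≡ 0#
  fromℕ-q≡0 = begin
    fromℕ q                   ≡⟨ cong fromℕ q≡pⁿ ⟩
    fromℕ (p ℕ.^ n)           ≡⟨ fromℕ-^ p n ⟩
    fromℕ p ^ n               ≡⟨ cong (_^ n) fromℕ-p≡0 ⟩
    0# ^ n                    ≡⟨ 0^n≡0 1≤n ⟩
    0#                        ∎

  2≢0 : 2# ≢ 0#
  2≢0 2≡0 = 0≢1 (begin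
    0#                          ≡⟨ fromℕ-q≡0 ⟨
    fromℕ q                     ≡⟨ cong fromℕ q≡1+h*2 ⟩
    fromℕ (1 ℕ.+ h ℕ.* 2)       ≡⟨ fromℕ-+ 1 (h ℕ.* 2) ⟩
    1# + fromℕ (h ℕ.* 2)        ≡⟨ cong (1# +_) (fromℕ-* h 2) ⟩
    1# + fromℕ h * 2#           ≡⟨ cong (λ z → 1# + fromℕ h * z) 2≡0 ⟩
    1# + fromℕ h * 0#           ≡⟨ cong (1# +_) (zeroʳ _) ⟩
    1# + 0#                     ≡⟨ +-identityʳ 1# ⟩
    1#                          ∎)

  3≤q : 3 ℕ.≤ q
  3≤q with h | q≡1+h*2
  ... | zero | q≡1 = ⊥-elim (0≢1 (sym (trans (cong fromℕ (sym q≡1)) fromℕ-q≡0)))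
  ... | suc _ | q≡3+2h′ = subst (3 ℕ.≤_) (sym q≡3+2h′) (ℕ.s≤s (ℕ.s≤s (ℕ.s≤s ℕ.z≤n)))

  1≤q : 1 ℕ.≤ q
  1≤q = ℕ.≤-trans (ℕ.s≤s ℕ.z≤n) 3≤q

  1≤q∸1 : 1 ℕ.≤ q ∸ 1
  1≤q∸1 = ℕ.≤-trans (ℕ.s≤s ℕ.z≤n) (ℕ.∸-monoˡ-≤ 1 3≤q)

  1≤2q∸2 : 1 ℕ.≤ 2 ℕ.* q ∸ 2
  1≤2q∸2 = ℕ.≤-trans (ℕ.∸-monoˡ-≤ 2 3≤q) (ℕ.∸-monoˡ-≤ 2 (ℕ.m≤n*m q 2))

  1≤2q∸1 : 1 ℕ.≤ 2 ℕ.* q ∸ 1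
  1≤2q∸1 = ℕ.≤-trans 1≤2q∸2 (ℕ.∸-monoʳ-≤ (2 ℕ.* q) (ℕ.s≤s ℕ.z≤n))

  q%4≡1⇒q≡1+4k : q % 4 ≡ 1 → Σ ℕ λ k → q ≡ suc ((k ℕ.+ k) ℕ.+ (k ℕ.+ k))
  q%4≡1⇒q≡1+4k q%4≡1 = q / 4 , trans (m≡m%n+[m/n]*n q 4) (trans (cong (ℕ._+ q / 4 ℕ.* 4) q%4≡1) (lemma (q / 4)))
    where lemma : ∀ k → 1 ℕ.+ k ℕ.* 4 ≡ suc ((k ℕ.+ k) ℕ.+ (k ℕ.+ k))
          lemma = solve-∀

  q%4≡3⇒q≡3+4k : q % 4 ≡ 3 → Σ ℕ λ k → q ≡ suc (suc (k ℕ.+ k) ℕ.+ suc (k ℕ.+ k))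
  q%4≡3⇒q≡3+4k q%4≡3 = q / 4 , trans (m≡m%n+[m/n]*n q 4) (trans (cong (ℕ._+ q / 4 ℕ.* 4) q%4≡3) (lemma (q / 4)))
    where lemma : ∀ k → 3 ℕ.+ k ℕ.* 4 ≡ suc (suc (k ℕ.+ k) ℕ.+ suc (k ℕ.+ k))
          lemma = solve-∀

  q*q≡size : q ℕ.* q ≡ size
  q*q≡size = trans (cong (q ℕ.*_) (sym (ℕ.*-identityʳ q))) (sym |F|≡q²)

  ^q-+ : ∀ x y → (x + y) ^ q ≡ x ^ q + y ^ q
  ^q-+ x y = subst (λ m → (x + y) ^ m ≡ x ^ m + y ^ m) (sym q≡pⁿ) (^pⁿ-+ p-prime fromℕ-p≡0 n x y)

  ^q-^q : ∀ x → (x ^ q) ^ q ≡ x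
  ^q-^q x = trans (^-assocʳ x q q) (trans (cong (x ^_) q*q≡size) (x^size≡x x))

  ^q-neg : ∀ x → (- x) ^ q ≡ - (x ^ q)
  ^q-neg x = +-inverseʳ-unique (x ^ q) ((- x) ^ q) (begin
    x ^ q + (- x) ^ q         ≡⟨ ^q-+ x (- x) ⟨
    (x - x) ^ q               ≡⟨ cong (_^ q) (-‿inverseʳ x) ⟩
    0# ^ q                    ≡⟨ 0^n≡0 1≤q ⟩
    0#                        ∎)

  ⁻¹-^q : ∀ {x} → x ≢ 0# → (x ⁻¹) ^ q ≡ (x ^ q) ⁻¹
  ⁻¹-^q {x} x≢0 = x*y≡1⇒y≡x⁻¹ (begin
    x ^ q * (x ⁻¹) ^ q        ≡⟨ ^-distrib-* x (x ⁻¹) q ⟨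
    (x * x ⁻¹) ^ q            ≡⟨ cong (_^ q) (x*x⁻¹≡1 x≢0) ⟩
    1# ^ q                    ≡⟨ 1^n≡1 q ⟩
    1#                        ∎)

  ^2q≡^q*^q : ∀ y → y ^ (2 ℕ.* q) ≡ y ^ q * y ^ q
  ^2q≡^q*^q y = trans (cong (λ m → y ^ (q ℕ.+ m)) (ℕ.+-identityʳ q)) (^-homo-* y q q)

  InFq-0 : InFq q 0#
  InFq-0 = 0^n≡0 1≤q

  InFq-1 : InFq q 1#
  InFq-1 = 1^n≡1 q

  InFq-+ : ∀ {x y} → InFq q x → InFq q y → InFq q (x + y)
  InFq-+ {x} {y} x∈ y∈ = trans (^q-+ x y) (cong₂ _+_ x∈ y∈)

  InFq-* : ∀ {x y} → InFq q x → InFq q y → InFq q (x * y)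
  InFq-* {x} {y} x∈ y∈ = trans (^-distrib-* x y q) (cong₂ _*_ x∈ y∈)

  InFq-neg : ∀ {x} → InFq q x → InFq q (- x)
  InFq-neg {x} x∈ = trans (^q-neg x) (cong -_ x∈)

  InFq-^ : ∀ {x} k → InFq q x → InFq q (x ^ k)
  InFq-^ zero x∈ = InFq-1
  InFq-^ (suc k) x∈ = InFq-* x∈ (InFq-^ k x∈)

  InFq-⁻¹ : ∀ {x} → x ≢ 0# → InFq q x → InFq q (x ⁻¹)
  InFq-⁻¹ x≢0 x∈ = trans (⁻¹-^q x≢0) (cong _⁻¹ x∈)

  InFq-2 : InFq q 2#
  InFq-2 = InFq-+ InFq-1 InFq-1

  2*x≡0⇒x≡0 : ∀ {x} → 2# * x ≡ 0# → x ≡ 0#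
  2*x≡0⇒x≡0 {x} 2x≡0 = *-cancelˡ 2≢0 (trans 2x≡0 (sym (zeroʳ 2#)))

  x≢0⇒x≢-x : ∀ {x} → x ≢ 0# → x ≢ - x
  x≢0⇒x≢-x {x} x≢0 x≡-x = x≢0 (2*x≡0⇒x≡0 (begin
    2# * x      ≡⟨ solve 1 (λ x → con (ℤ.+ 2) :* x := x :+ x) refl x ⟩
    x + x       ≡⟨ cong (x +_) x≡-x ⟩
    x - x       ≡⟨ -‿inverseʳ x ⟩
    0#          ∎))

  unit : Fin 6 → Vecₙ 6
  unit j i with j Fin.≟ i
  ... | yes _ = 1#
  ... | no _ = 0#

  unit-FqVec : ∀ j → FqVec q 6 (unit j)
  unit-FqVec j i with j Fin.≟ i
  ... | yes _ = InFq-1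
  ... | no _ = InFq-0

  embedBase-FqVec : ∀ {u} → FqVec q 6 u → FqVec q 7 (embedBase u)
  embedBase-FqVec u∈ = λ where
    0F → u∈ 0F ; 1F → u∈ 1F ; 2F → u∈ 2F ; 3F → u∈ 3F ; 4F → u∈ 4F ; 5F → InFq-0 ; 6F → u∈ 5F

  private
    open Inverse enumeration using (to; from; strictlyInverseˡ)

    index : Carrier → ℕ
    index x = toℕ (from x)

    index-injective : ∀ {x y} → index x ≡ index y → x ≡ y
    index-injective {x} {y} eq = begin
      x              ≡⟨ strictlyInverseˡ x ⟨
      to (from x)    ≡⟨ cong to (Fin.toℕ-injective eq) ⟩
      to (from y)    ≡⟨ strictlyInverseˡ y ⟩
      y              ∎

    -- Of each pair x, - x of nonzero elements of F_q exactly one is positive.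
    Positive : Carrier → Set
    Positive x = InFq q x × index x ℕ.< index (- x)

    halfSystem : List Carrier
    halfSystem = filter (λ x → (x ^ q ≟ x) ×-dec (index x ℕ.<? index (- x))) elements

    halfSystem-positive : All Positive halfSystem
    halfSystem-positive = All.all-filter _ elements

    halfSystem-unique : Unique halfSystem
    halfSystem-unique = Unique.filter⁺ _ elements-unique

    Positive⇒≢0 : ∀ {x} → Positive x → x ≢ 0#
    Positive⇒≢0 (_ , x<-x) refl = ℕ.<-irrefl (cong index (sym -0#≈0#)) x<-x

    Positive⇒≢-Positive : ∀ {x y} → Positive x → Positive y → x ≢ - y
    Positive⇒≢-Positive {x} {y} (_ , x<-x) (_ , y<-y) refl =
      ℕ.<-asym x<-x (subst (λ z → index z ℕ.< index (- y)) (sym (-‿involutive y)) y<-y)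

    InFq⇒≡0∨±∈halfSystem : ∀ {x} → InFq q x → x ≡ 0# ⊎ x ∈ halfSystem ⊎ - x ∈ halfSystem
    InFq⇒≡0∨±∈halfSystem {x} x∈ with x ≟ 0#
    ... | yes x≡0 = inj₁ x≡0
    ... | no x≢0 with ℕ.<-cmp (index x) (index (- x))
    ...   | tri< x<-x _ _ = inj₂ (inj₁ (∈-filter⁺ _ (∈-elements x) (x∈ , x<-x)))
    ...   | tri≈ _ x≡-x _ = ⊥-elim (x≢0⇒x≢-x x≢0 (index-injective x≡-x))
    ...   | tri> _ _ -x<x = inj₂ (inj₂ (∈-filter⁺ _ (∈-elements (- x))
                              (InFq-neg x∈ , subst (λ z → index (- x) ℕ.< index z) (sym (-‿involutive x)) -x<x)))

    _≢±_ : Carrier → Carrier → Set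
    x ≢± y = x ≢ y × x ≢ - y

    halfSystem-≢± : AllPairs _≢±_ halfSystem
    halfSystem-≢± = unique∧positive⇒≢± halfSystem-unique halfSystem-positive
      where
      unique∧positive⇒≢± : ∀ {xs} → Unique xs → All Positive xs → AllPairs _≢±_ xs
      unique∧positive⇒≢± [] [] = []
      unique∧positive⇒≢± (x∉xs ∷ xs!) (x+ ∷ xs+) =
        All.zipWith (λ (x≢y , y+) → x≢y , Positive⇒≢-Positive x+ y+) (x∉xs , xs+) ∷ unique∧positive⇒≢± xs! xs+

    representatives : List Carrier
    representatives = 0# ∷ halfSystem

    representatives-InFq : All (InFq q) representatives
    representatives-InFq = InFq-0 ∷ All.map proj₁ halfSystem-positive

    representatives-≢± : AllPairs _≢±_ representatives
    representatives-≢± = All.map 0≢±positive halfSystem-positive ∷ halfSystem-≢±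
      where
      0≢±positive : ∀ {y} → Positive y → 0# ≢± y
      0≢±positive y+ = (λ 0≡y → Positive⇒≢0 y+ (sym 0≡y)) , (λ 0≡-y → Positive⇒≢0 y+ (-x≡0⇒x≡0 (sym 0≡-y)))

    Fq-elements : List Carrier
    Fq-elements = 0# ∷ halfSystem ++ map -_ halfSystem

    InFq⇒∈Fq-elements : ∀ {x} → InFq q x → x ∈ Fq-elements
    InFq⇒∈Fq-elements x∈ with InFq⇒≡0∨±∈halfSystem x∈
    ... | inj₁ refl = here refl
    ... | inj₂ (inj₁ x∈H) = there (∈-++⁺ˡ x∈H)
    ... | inj₂ (inj₂ -x∈H) = there (∈-++⁺ʳ halfSystem (subst (_∈ map -_ halfSystem) (-‿involutive _) (∈-map⁺ -_ -x∈H)))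

  -- The (q+1)/2 squares x² and the (q+1)/2 values c + D y² cannot all be distinct in F_q.
  x*x≡c+D*y*y : ∀ {c D} → InFq q c → InFq q D → D ≢ 0# →
                Σ Carrier λ x → Σ Carrier λ y → InFq q x × InFq q y × x * x ≡ c + D * (y * y)
  x*x≡c+D*y*y {c} {D} c∈ D∈ D≢0
    with any? (λ x → any? (λ y → x * x ≟ c + D * (y * y)) representatives) representatives
  ... | yes found with x∈ , found′ ← All.lookupAny representatives-InFq found
                  with y∈ , x²≡c+Dy² ← All.lookupAny representatives-InFq found′
    = _ , _ , x∈ , y∈ , x²≡c+Dy²
  ... | no none = ⊥-elim (ℕ.<-irrefl refl (ℕ.≤-trans too-long (Unique⇒length≤ values-unique values⊆Fq)))
    where
    square shift : Carrier → Carrier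
    square x = x * x
    shift y = c + D * (y * y)
    values : List Carrier
    values = map square representatives ++ map shift representatives
    shift-injective : ∀ {x y} → x ≢± y → shift x ≢ shift y
    shift-injective {x} {y} x≢±y shift-x≡shift-y =
      [ proj₁ x≢±y , proj₂ x≢±y ]′ (x*x≡y*y⇒x≡±y (*-cancelˡ D≢0 (+-cancelˡ c _ _ shift-x≡shift-y)))
    square-injective : ∀ {x y} → x ≢± y → square x ≢ square y
    square-injective x≢±y x*x≡y*y = [ proj₁ x≢±y , proj₂ x≢±y ]′ (x*x≡y*y⇒x≡±y x*x≡y*y)
    values-unique : Unique values
    values-unique = Unique.++⁺
      (AllPairs.map⁺ (AllPairs.map square-injective representatives-≢±))
      (AllPairs.map⁺ (AllPairs.map shift-injective representatives-≢±))
      λ (v∈squares , v∈shifts) →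
        let x , x∈ , v≡x² = ∈-map⁻ square v∈squares
            y , y∈ , v≡c+Dy² = ∈-map⁻ shift v∈shifts
        in none (lose x∈ (lose y∈ (trans (sym v≡x²) v≡c+Dy²)))
    values-InFq : All (InFq q) values
    values-InFq = All.++⁺
      (All.map⁺ (All.map (λ x∈ → InFq-* x∈ x∈) representatives-InFq))
      (All.map⁺ (All.map (λ y∈ → InFq-+ c∈ (InFq-* D∈ (InFq-* y∈ y∈))) representatives-InFq))
    values⊆Fq : values ⊆ Fq-elements
    values⊆Fq v∈ = InFq⇒∈Fq-elements (All.lookup values-InFq v∈)
    H : ℕ
    H = length halfSystem
    too-long : length Fq-elements ℕ.< length values
    too-long = subst₂ ℕ._<_
      (cong suc (sym (trans (List.length-++ halfSystem) (cong (H ℕ.+_) (List.length-map -_ halfSystem)))))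
      (sym (trans (List.length-++ (map square representatives))
                  (trans (cong₂ ℕ._+_ (List.length-map square representatives) (List.length-map shift representatives))
                         (cong suc (ℕ.+-suc H H)))))
      (ℕ.n<1+n (suc (H ℕ.+ H)))

  module QuadraticExtension (ε : Carrier) (ε∉Fq : ¬ InFq q ε) (ε^q≡-ε : ε ^ q ≡ - ε) where
    δ : Carrier
    δ = ε * ε

    ε≢0 : ε ≢ 0#
    ε≢0 ε≡0 = ε∉Fq (subst (InFq q) (sym ε≡0) InFq-0)

    InFq-δ : InFq q δ
    InFq-δ = begin
      (ε * ε) ^ q               ≡⟨ ^-distrib-* ε ε q ⟩
      ε ^ q * ε ^ q             ≡⟨ cong₂ _*_ ε^q≡-ε ε^q≡-ε ⟩
      (- ε) * (- ε)             ≡⟨ solve 1 (λ e → (:- e) :* (:- e) := e :* e) refl ε ⟩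
      ε * ε                     ∎

    conj : ∀ {c₀ c₁} → InFq q c₀ → InFq q c₁ → (c₀ + ε * c₁) ^ q ≡ c₀ - ε * c₁
    conj {c₀} {c₁} c₀∈ c₁∈ = begin
      (c₀ + ε * c₁) ^ q         ≡⟨ ^q-+ c₀ (ε * c₁) ⟩
      c₀ ^ q + (ε * c₁) ^ q     ≡⟨ cong (c₀ ^ q +_) (^-distrib-* ε c₁ q) ⟩
      c₀ ^ q + ε ^ q * c₁ ^ q   ≡⟨ cong₂ (λ u v → u + v * c₁ ^ q) c₀∈ ε^q≡-ε ⟩
      c₀ + (- ε) * c₁ ^ q       ≡⟨ cong (λ u → c₀ + (- ε) * u) c₁∈ ⟩
      c₀ + (- ε) * c₁           ≡⟨ cong (c₀ +_) (-‿distribˡ-* ε c₁) ⟨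
      c₀ - ε * c₁               ∎

    -- Conjugating A + εB = 0 gives A - εB = 0, hence 2εB = 0.
    A+εB≡0⇒A≡0∧B≡0 : ∀ {A B} → InFq q A → InFq q B → A + ε * B ≡ 0# → A ≡ 0# × B ≡ 0#
    A+εB≡0⇒A≡0∧B≡0 {A} {B} A∈ B∈ A+εB≡0 = A≡0 , B≡0
      where
      A-εB≡0 : A - ε * B ≡ 0#
      A-εB≡0 = trans (sym (conj A∈ B∈)) (trans (cong (_^ q) A+εB≡0) InFq-0)
      2εB≡0 : (2# * ε) * B ≡ 0#
      2εB≡0 = begin
        (2# * ε) * B                        ≡⟨ solve 3 (λ a e b → (con (ℤ.+ 2) :* e) :* b := (a :+ e :* b) :- (a :- e :* b)) refl A ε B ⟩
        (A + ε * B) - (A - ε * B)           ≡⟨ cong₂ _-_ A+εB≡0 A-εB≡0 ⟩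
        0# - 0#                             ≡⟨ -‿inverseʳ 0# ⟩
        0#                                  ∎
      B≡0 : B ≡ 0#
      B≡0 = *-cancelˡ (x≢0∧y≢0⇒x*y≢0 2≢0 ε≢0) (trans 2εB≡0 (sym (zeroʳ _)))
      A≡0 : A ≡ 0#
      A≡0 = begin
        A                   ≡⟨ solve 3 (λ a e b → a := (a :+ e :* b) :- e :* b) refl A ε B ⟩
        (A + ε * B) - ε * B ≡⟨ cong₂ (λ u v → u - ε * v) A+εB≡0 B≡0 ⟩
        0# - ε * 0#         ≡⟨ solve 1 (λ e → con (ℤ.+ 0) :- e :* con (ℤ.+ 0) := con (ℤ.+ 0)) refl ε ⟩
        0#                  ∎

    decompose : ∀ x → Σ Carrier λ c₀ → Σ Carrier λ c₁ → Decomp q ε x c₀ c₁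
    decompose x = c₀ , c₁ , c₀∈ , c₁∈ , x≡c₀+εc₁
      where
      c₀ c₁ : Carrier
      c₀ = (x + x ^ q) * 2# ⁻¹
      c₁ = (x - x ^ q) * (2# * ε) ⁻¹
      2ε≢0 : 2# * ε ≢ 0#
      2ε≢0 = x≢0∧y≢0⇒x*y≢0 2≢0 ε≢0
      c₀∈ : InFq q c₀
      c₀∈ = begin
        ((x + x ^ q) * 2# ⁻¹) ^ q              ≡⟨ ^-distrib-* (x + x ^ q) (2# ⁻¹) q ⟩
        (x + x ^ q) ^ q * (2# ⁻¹) ^ q          ≡⟨ cong (_* (2# ⁻¹) ^ q) (^q-+ x (x ^ q)) ⟩
        (x ^ q + (x ^ q) ^ q) * (2# ⁻¹) ^ q    ≡⟨ cong₂ (λ u v → (x ^ q + u) * v) (^q-^q x) (InFq-⁻¹ 2≢0 InFq-2) ⟩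
        (x ^ q + x) * 2# ⁻¹                    ≡⟨ cong (_* 2# ⁻¹) (+-comm (x ^ q) x) ⟩
        (x + x ^ q) * 2# ⁻¹                    ∎
      [2ε]⁻¹^q : ((2# * ε) ⁻¹) ^ q ≡ - (2# * ε) ⁻¹
      [2ε]⁻¹^q = begin
        ((2# * ε) ⁻¹) ^ q      ≡⟨ ⁻¹-^q 2ε≢0 ⟩
        ((2# * ε) ^ q) ⁻¹      ≡⟨ cong _⁻¹ (trans (^-distrib-* 2# ε q) (cong₂ _*_ InFq-2 ε^q≡-ε)) ⟩
        (2# * - ε) ⁻¹          ≡⟨ cong _⁻¹ (-‿distribʳ-* 2# ε) ⟨
        (- (2# * ε)) ⁻¹        ≡⟨ -‿⁻¹ 2ε≢0 ⟩
        - (2# * ε) ⁻¹          ∎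
      c₁∈ : InFq q c₁
      c₁∈ = begin
        ((x - x ^ q) * (2# * ε) ⁻¹) ^ q               ≡⟨ ^-distrib-* (x - x ^ q) ((2# * ε) ⁻¹) q ⟩
        (x - x ^ q) ^ q * ((2# * ε) ⁻¹) ^ q           ≡⟨ cong₂ _*_ (^q-+ x (- x ^ q)) [2ε]⁻¹^q ⟩
        (x ^ q + (- x ^ q) ^ q) * - (2# * ε) ⁻¹       ≡⟨ cong (λ u → (x ^ q + u) * - (2# * ε) ⁻¹) (trans (^q-neg (x ^ q)) (cong -_ (^q-^q x))) ⟩
        (x ^ q - x) * - (2# * ε) ⁻¹                   ≡⟨ solve 3 (λ x y z → (y :- x) :* (:- z) := (x :- y) :* z) refl x (x ^ q) ((2# * ε) ⁻¹) ⟩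
        (x - x ^ q) * (2# * ε) ⁻¹                     ∎
      ε[2ε]⁻¹≡2⁻¹ : ε * (2# * ε) ⁻¹ ≡ 2# ⁻¹
      ε[2ε]⁻¹≡2⁻¹ = x*y≡1⇒y≡x⁻¹ (trans (sym (*-assoc 2# ε _)) (x*x⁻¹≡1 2ε≢0))
      x≡c₀+εc₁ : x ≡ c₀ + ε * c₁
      x≡c₀+εc₁ = sym (begin
        (x + x ^ q) * 2# ⁻¹ + ε * ((x - x ^ q) * (2# * ε) ⁻¹)
          ≡⟨ solve 5 (λ x y h e k → (x :+ y) :* h :+ e :* ((x :- y) :* k) := (x :+ y) :* h :+ (x :- y) :* (e :* k))
                     refl x (x ^ q) (2# ⁻¹) ε ((2# * ε) ⁻¹) ⟩
        (x + x ^ q) * 2# ⁻¹ + (x - x ^ q) * (ε * (2# * ε) ⁻¹)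
          ≡⟨ cong (λ z → (x + x ^ q) * 2# ⁻¹ + (x - x ^ q) * z) ε[2ε]⁻¹≡2⁻¹ ⟩
        (x + x ^ q) * 2# ⁻¹ + (x - x ^ q) * 2# ⁻¹
          ≡⟨ solve 3 (λ x y h → (x :+ y) :* h :+ (x :- y) :* h := x :* (con (ℤ.+ 2) :* h)) refl x (x ^ q) (2# ⁻¹) ⟩
        x * (2# * 2# ⁻¹)   ≡⟨ cong (x *_) (x*x⁻¹≡1 2≢0) ⟩
        x * 1#             ≡⟨ *-identityʳ x ⟩
        x                  ∎)

    ε^m*ε^m≡-1 : ∀ m → q ≡ suc (m ℕ.+ m) → ε ^ m * ε ^ m ≡ - 1#
    ε^m*ε^m≡-1 m q≡1+2m = *-cancelˡ ε≢0 (begin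
      ε * (ε ^ m * ε ^ m)     ≡⟨ cong (ε *_) (^-homo-* ε m m) ⟨
      ε ^ suc (m ℕ.+ m)       ≡⟨ cong (ε ^_) q≡1+2m ⟨
      ε ^ q                   ≡⟨ ε^q≡-ε ⟩
      - ε                     ≡⟨ solve 1 (λ e → :- e := e :* (:- con (ℤ.+ 1))) refl ε ⟩
      ε * - 1#                ∎)

    ε^[k+k]≡δ^k : ∀ k → ε ^ (k ℕ.+ k) ≡ δ ^ k
    ε^[k+k]≡δ^k k = trans (^-homo-* ε k k) (sym (^-distrib-* ε ε k))

    i : Carrier
    i = ε ^ h

    i*i≡-1 : i * i ≡ - 1#
    i*i≡-1 = ε^m*ε^m≡-1 h (trans q≡1+h*2 (cong suc (lemma h)))
      where lemma : ∀ h → h ℕ.* 2 ≡ h ℕ.+ h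
            lemma = solve-∀

    r*r≡-1⇒r≡±i : ∀ {r} → r * r ≡ - 1# → r ≡ i ⊎ r ≡ - i
    r*r≡-1⇒r≡±i r*r≡-1 = x*x≡y*y⇒x≡±y (trans r*r≡-1 (sym i*i≡-1))

    i≢-i : i ≢ - i
    i≢-i = x≢0⇒x≢-x i≢0
      where
      i≢0 : i ≢ 0#
      i≢0 i≡0 = 0≢1 (sym (-x≡0⇒x≡0 (trans (sym i*i≡-1) (trans (cong (_* i) i≡0) (zeroˡ i)))))

    q%4≡1⇒√-1∈Fq : q % 4 ≡ 1 → ∀ {r} → r * r ≡ - 1# → InFq q r
    q%4≡1⇒√-1∈Fq q%4≡1 r*r≡-1 with k , q≡1+4k ← q%4≡1⇒q≡1+4k q%4≡1
      with x*x≡y*y⇒x≡±y (trans r*r≡-1 (sym (ε^m*ε^m≡-1 (k ℕ.+ k) q≡1+4k)))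
    ... | inj₁ r≡j = subst (InFq q) (sym (trans r≡j (ε^[k+k]≡δ^k k))) (InFq-^ k InFq-δ)
    ... | inj₂ r≡-j = subst (InFq q) (sym (trans r≡-j (cong -_ (ε^[k+k]≡δ^k k)))) (InFq-neg (InFq-^ k InFq-δ))

    q%4≡3⇒√-1∈εFq : q % 4 ≡ 3 → ∀ {r} → r * r ≡ - 1# → Σ Carrier λ s → InFq q s × r ≡ ε * s
    q%4≡3⇒√-1∈εFq q%4≡3 r*r≡-1 with k , q≡3+4k ← q%4≡3⇒q≡3+4k q%4≡3
      with x*x≡y*y⇒x≡±y (trans r*r≡-1 (sym (ε^m*ε^m≡-1 (suc (k ℕ.+ k)) q≡3+4k)))
    ... | inj₁ r≡j = δ ^ k , InFq-^ k InFq-δ , trans r≡j (cong (ε *_) (ε^[k+k]≡δ^k k))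
    ... | inj₂ r≡-j = - δ ^ k , InFq-neg (InFq-^ k InFq-δ) ,
                      trans r≡-j (trans (cong (λ z → - (ε * z)) (ε^[k+k]≡δ^k k)) (-‿distribʳ-* ε (δ ^ k)))

    q%4≡1⇒u*uᵠ+v*vᵠ≡0 : q % 4 ≡ 1 → ∀ {u v} → u * u + v * v ≡ 0# → u * u ^ q + v * v ^ q ≡ 0#
    q%4≡1⇒u*uᵠ+v*vᵠ≡0 q%4≡1 {u} {v} u²+v²≡0 with v ≟ 0#
    ... | yes v≡0 = begin
      u * u ^ q + v * v ^ q           ≡⟨ cong₂ (λ s t → s * s ^ q + t * t ^ q) (u*u+v*v≡0⇒v≡0⇒u≡0 u²+v²≡0 v≡0) v≡0 ⟩
      0# * 0# ^ q + 0# * 0# ^ q       ≡⟨ solve 1 (λ z → con (ℤ.+ 0) :* z :+ con (ℤ.+ 0) :* z := con (ℤ.+ 0)) refl (0# ^ q) ⟩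
      0#                              ∎
    ... | no v≢0 = begin
      u * u ^ q + v * v ^ q           ≡⟨ cong (λ s → s * s ^ q + v * v ^ q) u≡v*r ⟩
      (v * r) * (v * r) ^ q + v * v ^ q ≡⟨ cong (λ s → (v * r) * s + v * v ^ q) (^-distrib-* v r q) ⟩
      (v * r) * (v ^ q * r ^ q) + v * v ^ q
                                      ≡⟨ cong (λ s → (v * r) * (v ^ q * s) + v * v ^ q) (q%4≡1⇒√-1∈Fq q%4≡1 r*r≡-1) ⟩
      (v * r) * (v ^ q * r) + v * v ^ q ≡⟨ solve 3 (λ v r w → (v :* r) :* (w :* r) :+ v :* w := (r :* r :+ con (ℤ.+ 1)) :* (v :* w)) refl v r (v ^ q) ⟩
      (r * r + 1#) * (v * v ^ q)      ≡⟨ cong (λ s → (s + 1#) * (v * v ^ q)) r*r≡-1 ⟩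
      (- 1# + 1#) * (v * v ^ q)       ≡⟨ cong (_* (v * v ^ q)) (-‿inverseˡ 1#) ⟩
      0# * (v * v ^ q)                ≡⟨ zeroˡ _ ⟩
      0#                              ∎
      where
      r : Carrier
      r = v ⁻¹ * u
      r*r≡-1 : r * r ≡ - 1#
      r*r≡-1 = u*u+v*v≡0⇒[u/v]²≡-1 v≢0 u²+v²≡0
      u≡v*r : u ≡ v * r
      u≡v*r = sym (trans (sym (*-assoc v (v ⁻¹) u)) (trans (cong (_* u) (x*x⁻¹≡1 v≢0)) (*-identityˡ u)))

    sum-of-squares : ∀ c₀ c₁ c₂ c₃ →
      (c₀ + ε * c₁) * (c₀ + ε * c₁) + (c₂ + ε * c₃) * (c₂ + ε * c₃)
        ≡ (c₀ * c₀ + δ * (c₁ * c₁) + c₂ * c₂ + δ * (c₃ * c₃)) + ε * (2# * (c₀ * c₁ + c₂ * c₃))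
    sum-of-squares c₀ c₁ c₂ c₃ = solve 5 (λ c₀ c₁ c₂ c₃ e →
      (c₀ :+ e :* c₁) :* (c₀ :+ e :* c₁) :+ (c₂ :+ e :* c₃) :* (c₂ :+ e :* c₃)
      := (c₀ :* c₀ :+ e :* e :* (c₁ :* c₁) :+ c₂ :* c₂ :+ e :* e :* (c₃ :* c₃)) :+ e :* (con (ℤ.+ 2) :* (c₀ :* c₁ :+ c₂ :* c₃)))
      refl c₀ c₁ c₂ c₃ ε

    sum-of-norms : ∀ {c₀ c₁ c₂ c₃} → InFq q c₀ → InFq q c₁ → InFq q c₂ → InFq q c₃ →
      (c₀ + ε * c₁) * (c₀ + ε * c₁) ^ q + (c₂ + ε * c₃) * (c₂ + ε * c₃) ^ q
        ≡ c₀ * c₀ - δ * (c₁ * c₁) + c₂ * c₂ - δ * (c₃ * c₃)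
    sum-of-norms {c₀} {c₁} {c₂} {c₃} c₀∈ c₁∈ c₂∈ c₃∈ = begin
      (c₀ + ε * c₁) * (c₀ + ε * c₁) ^ q + (c₂ + ε * c₃) * (c₂ + ε * c₃) ^ q
        ≡⟨ cong₂ (λ s t → (c₀ + ε * c₁) * s + (c₂ + ε * c₃) * t) (conj c₀∈ c₁∈) (conj c₂∈ c₃∈) ⟩
      (c₀ + ε * c₁) * (c₀ - ε * c₁) + (c₂ + ε * c₃) * (c₂ - ε * c₃)
        ≡⟨ solve 5 (λ c₀ c₁ c₂ c₃ e →
             (c₀ :+ e :* c₁) :* (c₀ :- e :* c₁) :+ (c₂ :+ e :* c₃) :* (c₂ :- e :* c₃)
             := c₀ :* c₀ :- e :* e :* (c₁ :* c₁) :+ c₂ :* c₂ :- e :* e :* (c₃ :* c₃)) refl c₀ c₁ c₂ c₃ ε ⟩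
      c₀ * c₀ - δ * (c₁ * c₁) + c₂ * c₂ - δ * (c₃ * c₃)
        ∎

    -- Q′ as a solver polynomial in the coordinates x0, x1, x2, x3, x4, x6; it evaluates to Q′ definitionally.
    Q′ᴾ : ∀ {k} (δ a0 a1 b1 x0 x1 x2 x3 x4 x6 : Polynomial k) → Polynomial k
    Q′ᴾ δ a0 a1 b1 x0 x1 x2 x3 x4 x6 =
        x0 :* x6
      :+ con (ℤ.+ 2) :* a0 :* (x1 :* x2 :+ x3 :* x4)
      :+ a1 :* (x1 :^ 2 :+ x3 :^ 2 :+ δ :* (x2 :^ 2 :+ x4 :^ 2))
      :- b1 :* (x1 :^ 2 :- δ :* x2 :^ 2 :+ x3 :^ 2 :- δ :* x4 :^ 2)

    module Surface {a0 a1 b0 b1 : Carrier}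
                   (a0∈ : InFq q a0) (a1∈ : InFq q a1) (b0∈ : InFq q b0) (b1∈ : InFq q b1) where

      a b : Carrier
      a = a0 + ε * a1
      b = b0 + ε * b1

      Q : Vecₙ 7 → Carrier
      Q = Q′ δ a0 a1 b1

      Φ : (J X Y Z : Carrier) → Carrier
      Φ J X Y Z = ((Z ^ q) * (J ^ q) - Z * (J ^ (2 ℕ.* q ∸ 1))
                     + (a ^ q) * (X ^ (2 ℕ.* q) + Y ^ (2 ℕ.* q))
                     - a * (X ^ 2 + Y ^ 2) * (J ^ (2 ℕ.* q ∸ 2)))
                - ((b ^ q) - b) * (X ^ (q ℕ.+ 1) + Y ^ (q ℕ.+ 1)) * (J ^ (q ∸ 1))

      SurfaceEq⇒Φ≡0 : ∀ {J X Y Z} → SurfaceEq q a b J X Y Z → Φ J X Y Z ≡ 0#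
      SurfaceEq⇒Φ≡0 = x≈y⇒x∙y⁻¹≈ε

      Φ≡0⇒SurfaceEq : ∀ {J X Y Z} → Φ J X Y Z ≡ 0# → SurfaceEq q a b J X Y Z
      Φ≡0⇒SurfaceEq = x∙y⁻¹≈ε⇒x≈y _ _

      Φ-at-J≡1 : ∀ X Y Z → Φ 1# X Y Z ≡
        (Z ^ q - Z + a ^ q * (X ^ q * X ^ q + Y ^ q * Y ^ q) - a * (X ^ 2 + Y ^ 2)) - (b ^ q - b) * (X ^ q * X + Y ^ q * Y)
      Φ-at-J≡1 X Y Z
        rewrite 1^n≡1 q | 1^n≡1 (2 ℕ.* q ∸ 1) | 1^n≡1 (2 ℕ.* q ∸ 2) | 1^n≡1 (q ∸ 1)
              | ^2q≡^q*^q X | ^2q≡^q*^q Y | ^-homo-* X q 1 | ^-homo-* Y q 1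
        = solve 10 (λ Z̄ Z ā a X̄ X Ȳ Y b̄ b →
            (Z̄ :* con (ℤ.+ 1) :- Z :* con (ℤ.+ 1) :+ ā :* (X̄ :* X̄ :+ Ȳ :* Ȳ) :- a :* (X :^ 2 :+ Y :^ 2) :* con (ℤ.+ 1))
              :- (b̄ :- b) :* (X̄ :* (X :* con (ℤ.+ 1)) :+ Ȳ :* (Y :* con (ℤ.+ 1))) :* con (ℤ.+ 1)
            := (Z̄ :- Z :+ ā :* (X̄ :* X̄ :+ Ȳ :* Ȳ) :- a :* (X :^ 2 :+ Y :^ 2)) :- (b̄ :- b) :* (X̄ :* X :+ Ȳ :* Y))
            refl (Z ^ q) Z (a ^ q) a (X ^ q) X (Y ^ q) Y (b ^ q) b

      Φ-affine : ∀ x → FqVec q 6 x →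
        Φ 1# (x 0F + ε * x 1F) (x 2F + ε * x 3F) (x 4F + ε * x 5F) ≡ - (2# * ε) * Q (affPoint x)
      Φ-affine x x∈ = begin
        Φ 1# X Y Z                                             ≡⟨ Φ-at-J≡1 X Y Z ⟩
        Ψ (X ^ q) (Y ^ q) (Z ^ q) (a ^ q) (b ^ q)              ≡⟨ cong₂ (λ (X̄ , Ȳ) (Z̄ , ā , b̄) → Ψ X̄ Ȳ Z̄ ā b̄)
                                                                        (cong₂ _,_ (conj (x∈ 0F) (x∈ 1F)) (conj (x∈ 2F) (x∈ 3F)))
                                                                        (cong₂ _,_ (conj (x∈ 4F) (x∈ 5F)) (cong₂ _,_ (conj a0∈ a1∈) (conj b0∈ b1∈))) ⟩
        Ψ (x 0F - ε * x 1F) (x 2F - ε * x 3F) (x 4F - ε * x 5F) (a0 - ε * a1) (b0 - ε * b1)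
                                                               ≡⟨ solve 11 (λ x0 x1 x2 x3 x4 x5 e a0 a1 b0 b1 →
            let X = x0 :+ e :* x1 ; Y = x2 :+ e :* x3 ; Z = x4 :+ e :* x5
                X̄ = x0 :- e :* x1 ; Ȳ = x2 :- e :* x3 ; Z̄ = x4 :- e :* x5 in
            (Z̄ :- Z :+ (a0 :- e :* a1) :* (X̄ :* X̄ :+ Ȳ :* Ȳ) :- (a0 :+ e :* a1) :* (X :^ 2 :+ Y :^ 2))
              :- ((b0 :- e :* b1) :- (b0 :+ e :* b1)) :* (X̄ :* X :+ Ȳ :* Y)
            := :- (con (ℤ.+ 2) :* e) :* Q′ᴾ (e :* e) a0 a1 b1 (con (ℤ.+ 1)) x0 x1 x2 x3 x5)
            refl (x 0F) (x 1F) (x 2F) (x 3F) (x 4F) (x 5F) ε a0 a1 b0 b1 ⟩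
        - (2# * ε) * Q (affPoint x)                            ∎
        where
        open ≡-Reasoning
        X Y Z : Carrier
        X = x 0F + ε * x 1F
        Y = x 2F + ε * x 3F
        Z = x 4F + ε * x 5F
        Ψ : (X̄ Ȳ Z̄ ā b̄ : Carrier) → Carrier
        Ψ X̄ Ȳ Z̄ ā b̄ = (Z̄ - Z + ā * (X̄ * X̄ + Ȳ * Ȳ) - a * (X ^ 2 + Y ^ 2)) - (b̄ - b) * (X̄ * X + Ȳ * Y)

      affine-correspondence : ∀ x → FqVec q 6 x →
           (SurfaceEq q a b 1# (x 0F + ε * x 1F) (x 2F + ε * x 3F) (x 4F + ε * x 5F) → Q (affPoint x) ≡ 0#)
         × (Q (affPoint x) ≡ 0# → SurfaceEq q a b 1# (x 0F + ε * x 1F) (x 2F + ε * x 3F) (x 4F + ε * x 5F))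
      affine-correspondence x x∈ =
          (λ on-surface → *-cancelˡ -2ε≢0 (trans (sym (Φ-affine x x∈)) (trans (SurfaceEq⇒Φ≡0 on-surface) (sym (zeroʳ _)))))
        , (λ Q≡0 → Φ≡0⇒SurfaceEq (trans (Φ-affine x x∈) (trans (cong (- (2# * ε) *_) Q≡0) (zeroʳ _))))
        where
        -2ε≢0 : - (2# * ε) ≢ 0#
        -2ε≢0 -2ε≡0 = x≢0∧y≢0⇒x*y≢0 2≢0 ε≢0 (-x≡0⇒x≡0 -2ε≡0)

      D : Carrier
      D = a0 * a0 - δ * (a1 * a1) + δ * (b1 * b1)

      disc≡4D : 4# * (a ^ (q ℕ.+ 1)) + ((b ^ q) - b) ^ 2 ≡ 4# * D
      disc≡4D = begin
        4# * (a ^ (q ℕ.+ 1)) + ((b ^ q) - b) ^ 2          ≡⟨ cong₂ (λ u v → 4# * u + (v - b) ^ 2) (^-homo-* a q 1) (conj b0∈ b1∈) ⟩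
        4# * (a ^ q * a ^ 1) + ((b0 - ε * b1) - b) ^ 2    ≡⟨ cong (λ u → 4# * (u * a ^ 1) + ((b0 - ε * b1) - b) ^ 2) (conj a0∈ a1∈) ⟩
        4# * ((a0 - ε * a1) * a ^ 1) + ((b0 - ε * b1) - b) ^ 2
          ≡⟨ solve 5 (λ e a0 a1 b0 b1 →
               let 2ᴾ = con (ℤ.+ 2) in
               (2ᴾ :+ 2ᴾ) :* ((a0 :- e :* a1) :* (a0 :+ e :* a1) :^ 1) :+ ((b0 :- e :* b1) :- (b0 :+ e :* b1)) :^ 2
               := (2ᴾ :+ 2ᴾ) :* (a0 :* a0 :- e :* e :* (a1 :* a1) :+ e :* e :* (b1 :* b1))) refl ε a0 a1 b0 b1 ⟩
        4# * D                                            ∎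
        where open ≡-Reasoning

      disc≢0⇒D≢0 : 4# * (a ^ (q ℕ.+ 1)) + ((b ^ q) - b) ^ 2 ≢ 0# → D ≢ 0#
      disc≢0⇒D≢0 disc≢0 D≡0 = disc≢0 (trans disc≡4D (trans (cong (4# *_) D≡0) (zeroʳ 4#)))

      ∂Q : Fin 6 → Vecₙ 7 → Carrier
      ∂Q 0F x = x 6F
      ∂Q 1F x = 2# * ((a1 - b1) * x 1F + a0 * x 2F)
      ∂Q 2F x = 2# * (a0 * x 1F + δ * (a1 + b1) * x 2F)
      ∂Q 3F x = 2# * ((a1 - b1) * x 3F + a0 * x 4F)
      ∂Q 4F x = 2# * (a0 * x 3F + δ * (a1 + b1) * x 4F)
      ∂Q 5F x = x 0F

      polar-unitᴾ : Fin 6 → N-ary 10 (Polynomial 10) (Polynomial 10 × Polynomial 10)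
      polar-unitᴾ j δ a0 a1 b1 x0 x1 x2 x3 x4 x6 =
        Q′ᴾ δ a0 a1 b1 (x0 :+ e 0F) (x1 :+ e 1F) (x2 :+ e 2F) (x3 :+ e 3F) (x4 :+ e 4F) (x6 :+ e 5F)
          :- Q′ᴾ δ a0 a1 b1 x0 x1 x2 x3 x4 x6 :- Q′ᴾ δ a0 a1 b1 (e 0F) (e 1F) (e 2F) (e 3F) (e 4F) (e 5F)
        := ∂Qᴾ j
        where
        e : Fin 6 → Polynomial 10
        e i with j Fin.≟ i
        ... | yes _ = con (ℤ.+ 1)
        ... | no _ = con (ℤ.+ 0)
        ∂Qᴾ : Fin 6 → Polynomial 10
        ∂Qᴾ 0F = x6
        ∂Qᴾ 1F = con (ℤ.+ 2) :* ((a1 :- b1) :* x1 :+ a0 :* x2)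
        ∂Qᴾ 2F = con (ℤ.+ 2) :* (a0 :* x1 :+ δ :* (a1 :+ b1) :* x2)
        ∂Qᴾ 3F = con (ℤ.+ 2) :* ((a1 :- b1) :* x3 :+ a0 :* x4)
        ∂Qᴾ 4F = con (ℤ.+ 2) :* (a0 :* x3 :+ δ :* (a1 :+ b1) :* x4)
        ∂Qᴾ 5F = x0

      polar-unit : ∀ x j → Polar Q x (embedBase (unit j)) ≡ ∂Q j x
      polar-unit x 0F = solve 10 (polar-unitᴾ 0F) refl δ a0 a1 b1 (x 0F) (x 1F) (x 2F) (x 3F) (x 4F) (x 6F)
      polar-unit x 1F = solve 10 (polar-unitᴾ 1F) refl δ a0 a1 b1 (x 0F) (x 1F) (x 2F) (x 3F) (x 4F) (x 6F)
      polar-unit x 2F = solve 10 (polar-unitᴾ 2F) refl δ a0 a1 b1 (x 0F) (x 1F) (x 2F) (x 3F) (x 4F) (x 6F)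
      polar-unit x 3F = solve 10 (polar-unitᴾ 3F) refl δ a0 a1 b1 (x 0F) (x 1F) (x 2F) (x 3F) (x 4F) (x 6F)
      polar-unit x 4F = solve 10 (polar-unitᴾ 4F) refl δ a0 a1 b1 (x 0F) (x 1F) (x 2F) (x 3F) (x 4F) (x 6F)
      polar-unit x 5F = solve 10 (polar-unitᴾ 5F) refl δ a0 a1 b1 (x 0F) (x 1F) (x 2F) (x 3F) (x 4F) (x 6F)

      gram-block-injective : D ≢ 0# → ∀ {s t} →
        (a1 - b1) * s + a0 * t ≡ 0# → a0 * s + δ * (a1 + b1) * t ≡ 0# → s ≡ 0# × t ≡ 0#
      gram-block-injective D≢0 {s} {t} row₁≡0 row₂≡0 =
          cancel-D (begin
            - D * s                                                                   ≡⟨ solve 6 (λ δ a0 a1 b1 s t →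
                :- (a0 :* a0 :- δ :* (a1 :* a1) :+ δ :* (b1 :* b1)) :* s
                := δ :* (a1 :+ b1) :* ((a1 :- b1) :* s :+ a0 :* t) :- a0 :* (a0 :* s :+ δ :* (a1 :+ b1) :* t)) refl δ a0 a1 b1 s t ⟩
            δ * (a1 + b1) * ((a1 - b1) * s + a0 * t) - a0 * (a0 * s + δ * (a1 + b1) * t)  ≡⟨ cong₂ (λ u v → δ * (a1 + b1) * u - a0 * v) row₁≡0 row₂≡0 ⟩
            δ * (a1 + b1) * 0# - a0 * 0#                                              ≡⟨ u*0-v*0≡0 _ _ ⟩
            0#                                                                        ∎)
        , cancel-D (begin
            - D * t                                                                   ≡⟨ solve 6 (λ δ a0 a1 b1 s t →
                :- (a0 :* a0 :- δ :* (a1 :* a1) :+ δ :* (b1 :* b1)) :* t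
                := (a1 :- b1) :* (a0 :* s :+ δ :* (a1 :+ b1) :* t) :- a0 :* ((a1 :- b1) :* s :+ a0 :* t)) refl δ a0 a1 b1 s t ⟩
            (a1 - b1) * (a0 * s + δ * (a1 + b1) * t) - a0 * ((a1 - b1) * s + a0 * t)  ≡⟨ cong₂ (λ u v → (a1 - b1) * u - a0 * v) row₂≡0 row₁≡0 ⟩
            (a1 - b1) * 0# - a0 * 0#                                                  ≡⟨ u*0-v*0≡0 _ _ ⟩
            0#                                                                        ∎)
        where
        open ≡-Reasoning
        u*0-v*0≡0 : ∀ u v → u * 0# - v * 0# ≡ 0#
        u*0-v*0≡0 u v = trans (cong₂ _-_ (zeroʳ u) (zeroʳ v)) (-‿inverseʳ 0#)
        cancel-D : ∀ {s} → - D * s ≡ 0# → s ≡ 0#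
        cancel-D -Ds≡0 = *-cancelˡ (λ -D≡0 → D≢0 (-x≡0⇒x≡0 -D≡0)) (trans -Ds≡0 (sym (zeroʳ _)))

      polar-units≡0⇒∈⟨V⟩ : D ≢ 0# → ∀ x → (∀ j → Polar Q x (embedBase (unit j)) ≡ 0#) → ∀ i → x i ≡ x 5F * V i
      polar-units≡0⇒∈⟨V⟩ D≢0 x polar≡0 = λ where
          0F → vanishes (∂Q≡0 5F)
          1F → vanishes (proj₁ x₁x₂≡0)
          2F → vanishes (proj₂ x₁x₂≡0)
          3F → vanishes (proj₁ x₃x₄≡0)
          4F → vanishes (proj₂ x₃x₄≡0)
          5F → sym (*-identityʳ (x 5F))
          6F → vanishes (∂Q≡0 0F)
        where
        ∂Q≡0 : ∀ j → ∂Q j x ≡ 0#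
        ∂Q≡0 j = trans (sym (polar-unit x j)) (polar≡0 j)
        x₁x₂≡0 : x 1F ≡ 0# × x 2F ≡ 0#
        x₁x₂≡0 = gram-block-injective D≢0 (2*x≡0⇒x≡0 (∂Q≡0 1F)) (2*x≡0⇒x≡0 (∂Q≡0 2F))
        x₃x₄≡0 : x 3F ≡ 0# × x 4F ≡ 0#
        x₃x₄≡0 = gram-block-injective D≢0 (2*x≡0⇒x≡0 (∂Q≡0 3F)) (2*x≡0⇒x≡0 (∂Q≡0 4F))
        vanishes : ∀ {y} → y ≡ 0# → y ≡ x 5F * 0#
        vanishes y≡0 = trans y≡0 (sym (zeroʳ (x 5F)))

      V-InRadical : InRadical q 7 Q V
      V-InRadical =
          solve 4 (λ δ a0 a1 b1 → Q′ᴾ δ a0 a1 b1 O O O O O O := O) refl δ a0 a1 b1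
        , λ z _ → solve 10 (λ δ a0 a1 b1 z0 z1 z2 z3 z4 z6 →
                    Q′ᴾ δ a0 a1 b1 (O :+ z0) (O :+ z1) (O :+ z2) (O :+ z3) (O :+ z4) (O :+ z6)
                      :- Q′ᴾ δ a0 a1 b1 O O O O O O :- Q′ᴾ δ a0 a1 b1 z0 z1 z2 z3 z4 z6 := O)
                    refl δ a0 a1 b1 (z 0F) (z 1F) (z 2F) (z 3F) (z 4F) (z 6F)
        where
        O : ∀ {k} → Polynomial k
        O = con (ℤ.+ 0)

      radical⊆⟨V⟩ : D ≢ 0# → ∀ y → FqVec q 7 y → InRadical q 7 Q y →
                    Σ Carrier λ μ → InFq q μ × (∀ i → y i ≡ μ * V i)
      radical⊆⟨V⟩ D≢0 y y∈ (_ , polar≡0) =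
        y 5F , y∈ 5F , polar-units≡0⇒∈⟨V⟩ D≢0 y (λ j → polar≡0 _ (embedBase-FqVec (unit-FqVec j)))

      base-nondegenerate : D ≢ 0# → NonDegenerate q 6 (Qbase δ a0 a1 b1)
      base-nondegenerate D≢0 y _ (_ , polar≡0) = λ where
          0F → vanishes 0F ; 1F → vanishes 1F ; 2F → vanishes 2F ; 3F → vanishes 3F ; 4F → vanishes 4F ; 5F → vanishes 6F
        where
        vanishes : ∀ i → embedBase y i ≡ 0#
        vanishes i = trans (polar-units≡0⇒∈⟨V⟩ D≢0 (embedBase y) (λ j → polar≡0 (unit j) (unit-FqVec j)) i) (zeroˡ (V i))

      InFq-D : InFq q D
      InFq-D = InFq-+ (InFq-+ (InFq-* a0∈ a0∈) (InFq-neg (InFq-* InFq-δ (InFq-* a1∈ a1∈)))) (InFq-* InFq-δ (InFq-* b1∈ b1∈))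

      plane-u : Vecₙ 6
      plane-u = λ where 0F → 1# ; _ → 0#

      plane-v plane-w : Carrier → Carrier → Vecₙ 6
      plane-v x y = λ where 1F → 1# ; 3F → x - y * a0 ; 4F → y * (a1 - b1) ; _ → 0#
      plane-w x y = λ where 2F → 1# ; 3F → - (y * (δ * (a1 + b1))) ; 4F → x + y * a0 ; _ → 0#

      plane-u-FqVec : FqVec q 6 plane-u
      plane-u-FqVec = λ where 0F → InFq-1 ; 1F → InFq-0 ; 2F → InFq-0 ; 3F → InFq-0 ; 4F → InFq-0 ; 5F → InFq-0

      plane-v-FqVec : ∀ {x y} → InFq q x → InFq q y → FqVec q 6 (plane-v x y)
      plane-v-FqVec x∈ y∈ = λ where
        0F → InFq-0 ; 1F → InFq-1 ; 2F → InFq-0 ; 5F → InFq-0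
        3F → InFq-+ x∈ (InFq-neg (InFq-* y∈ a0∈))
        4F → InFq-* y∈ (InFq-+ a1∈ (InFq-neg b1∈))

      plane-w-FqVec : ∀ {x y} → InFq q x → InFq q y → FqVec q 6 (plane-w x y)
      plane-w-FqVec x∈ y∈ = λ where
        0F → InFq-0 ; 1F → InFq-0 ; 2F → InFq-1 ; 5F → InFq-0
        3F → InFq-neg (InFq-* y∈ (InFq-* InFq-δ (InFq-+ a1∈ b1∈)))
        4F → InFq-+ x∈ (InFq-* y∈ a0∈)

      plane-independent : ∀ x y → LinIndep3 q 6 plane-u (plane-v x y) (plane-w x y)
      plane-independent x y l m k _ _ _ lu+mv+kw≡0 =
          trans (sym (solve 3 (λ l m k → l :* I :+ (m :* O :+ k :* O) := l) refl l m k)) (lu+mv+kw≡0 0F)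
        , trans (sym (solve 3 (λ l m k → l :* O :+ (m :* I :+ k :* O) := m) refl l m k)) (lu+mv+kw≡0 1F)
        , trans (sym (solve 3 (λ l m k → l :* O :+ (m :* O :+ k :* I) := k) refl l m k)) (lu+mv+kw≡0 2F)
        where
        I O : Polynomial 3
        I = con (ℤ.+ 1)
        O = con (ℤ.+ 0)

      Qbase-on-plane : ∀ x y l m k →
        Qbase δ a0 a1 b1 ((l · plane-u) ⊕ ((m · plane-v x y) ⊕ (k · plane-w x y)))
          ≡ (1# + (x * x - D * (y * y))) * ((a1 - b1) * m * m + 2# * a0 * m * k + δ * (a1 + b1) * k * k)
      Qbase-on-plane x y l m k = solve 9 (λ l m k x y δ a0 a1 b1 →
          let I = con (ℤ.+ 1) ; O = con (ℤ.+ 0)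
              c : Polynomial 9 → Polynomial 9 → Polynomial 9 → Polynomial 9
              c uᵢ vᵢ wᵢ = l :* uᵢ :+ (m :* vᵢ :+ k :* wᵢ)
          in Q′ᴾ δ a0 a1 b1 (c I O O) (c O I O) (c O O I) (c O (x :- y :* a0) (:- (y :* (δ :* (a1 :+ b1)))))
                            (c O (y :* (a1 :- b1)) (x :+ y :* a0)) (c O O O)
             := (I :+ (x :* x :- (a0 :* a0 :- δ :* (a1 :* a1) :+ δ :* (b1 :* b1)) :* (y :* y)))
                :* ((a1 :- b1) :* m :* m :+ con (ℤ.+ 2) :* a0 :* m :* k :+ δ :* (a1 :+ b1) :* k :* k))
        refl l m k x y δ a0 a1 b1

      base-hyperbolic : D ≢ 0# → HyperbolicPG5 q (Qbase δ a0 a1 b1)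
      base-hyperbolic D≢0 =
          base-nondegenerate D≢0 , plane-u , plane-v x y , plane-w x y
        , plane-u-FqVec , plane-v-FqVec x∈ y∈ , plane-w-FqVec x∈ y∈ , plane-independent x y , isotropic
        where
        solution : Σ Carrier λ x → Σ Carrier λ y → InFq q x × InFq q y × x * x ≡ - 1# + D * (y * y)
        solution = x*x≡c+D*y*y (InFq-neg InFq-1) InFq-D D≢0
        x y : Carrier
        x = proj₁ solution
        y = proj₁ (proj₂ solution)
        x∈ : InFq q x
        x∈ = proj₁ (proj₂ (proj₂ solution))
        y∈ : InFq q y
        y∈ = proj₁ (proj₂ (proj₂ (proj₂ solution)))
        x²-Dy²≡-1 : x * x - D * (y * y) ≡ - 1#
        x²-Dy²≡-1 = begin
          x * x - D * (y * y)                  ≡⟨ cong (_- D * (y * y)) (proj₂ (proj₂ (proj₂ (proj₂ solution)))) ⟩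
          (- 1# + D * (y * y)) - D * (y * y)   ≡⟨ solve 2 (λ m d → (m :+ d) :- d := m) refl (- 1#) (D * (y * y)) ⟩
          - 1#                                 ∎
        isotropic : ∀ l m k → InFq q l → InFq q m → InFq q k →
                    Qbase δ a0 a1 b1 ((l · plane-u) ⊕ ((m · plane-v x y) ⊕ (k · plane-w x y))) ≡ 0#
        isotropic l m k _ _ _ = begin
          Qbase δ a0 a1 b1 ((l · plane-u) ⊕ ((m · plane-v x y) ⊕ (k · plane-w x y)))
                                               ≡⟨ Qbase-on-plane x y l m k ⟩
          (1# + (x * x - D * (y * y))) * B     ≡⟨ cong (λ z → (1# + z) * B) x²-Dy²≡-1 ⟩
          (1# + - 1#) * B                      ≡⟨ cong (_* B) (-‿inverseʳ 1#) ⟩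
          0# * B                               ≡⟨ zeroˡ B ⟩
          0#                                   ∎
          where
          B : Carrier
          B = (a1 - b1) * m * m + 2# * a0 * m * k + δ * (a1 + b1) * k * k

      Φ-at-infinity : ∀ u v w → Φ 0# u v w ≡ a ^ q * (u * u + v * v) ^ q
      Φ-at-infinity u v w
        rewrite 0^n≡0 1≤q | 0^n≡0 1≤2q∸1 | 0^n≡0 1≤2q∸2 | 0^n≡0 1≤q∸1 = begin
          (w ^ q * 0# - w * 0# + a ^ q * (u ^ (2 ℕ.* q) + v ^ (2 ℕ.* q)) - a * (u ^ 2 + v ^ 2) * 0#)
            - (b ^ q - b) * (u ^ (q ℕ.+ 1) + v ^ (q ℕ.+ 1)) * 0#
              ≡⟨ solve 8 (λ W w A U V a S T → (W :* O :- w :* O :+ A :* (U :+ V) :- a :* S :* O) :- T :* O := A :* (U :+ V))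
                         refl (w ^ q) w (a ^ q) (u ^ (2 ℕ.* q)) (v ^ (2 ℕ.* q)) a (u ^ 2 + v ^ 2) ((b ^ q - b) * (u ^ (q ℕ.+ 1) + v ^ (q ℕ.+ 1))) ⟩
          a ^ q * (u ^ (2 ℕ.* q) + v ^ (2 ℕ.* q))           ≡⟨ cong (a ^ q *_) (cong₂ _+_ (square-^q u) (square-^q v)) ⟩
          a ^ q * ((u * u) ^ q + (v * v) ^ q)               ≡⟨ cong (a ^ q *_) (^q-+ (u * u) (v * v)) ⟨
          a ^ q * (u * u + v * v) ^ q                       ∎
        where
        open ≡-Reasoning
        O : Polynomial 8
        O = con (ℤ.+ 0)
        square-^q : ∀ y → y ^ (2 ℕ.* q) ≡ (y * y) ^ q
        square-^q y = trans (^2q≡^q*^q y) (sym (^-distrib-* y y q))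

      at-infinity⇒u²+v²≡0 : a ≢ 0# → ∀ {u v w} → SurfaceEq q a b 0# u v w → u * u + v * v ≡ 0#
      at-infinity⇒u²+v²≡0 a≢0 {u} {v} {w} on-surface
        with x*y≡0⇒x≡0⊎y≡0 (trans (sym (Φ-at-infinity u v w)) (SurfaceEq⇒Φ≡0 on-surface))
      ... | inj₁ aᵠ≡0 = ⊥-elim (x≢0⇒x^n≢0 q a≢0 aᵠ≡0)
      ... | inj₂ [u²+v²]ᵠ≡0 = x^n≡0⇒x≡0 q [u²+v²]ᵠ≡0

      u²+v²≡0⇒at-infinity : ∀ {u v w} → u * u + v * v ≡ 0# → SurfaceEq q a b 0# u v w
      u²+v²≡0⇒at-infinity {u} {v} {w} u²+v²≡0 = Φ≡0⇒SurfaceEq (begin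
        Φ 0# u v w                    ≡⟨ Φ-at-infinity u v w ⟩
        a ^ q * (u * u + v * v) ^ q   ≡⟨ cong (λ z → a ^ q * z ^ q) u²+v²≡0 ⟩
        a ^ q * 0# ^ q                ≡⟨ cong (a ^ q *_) InFq-0 ⟩
        a ^ q * 0#                    ≡⟨ zeroʳ _ ⟩
        0#                            ∎)
        where open ≡-Reasoning

      chart : Carrier → Carrier → Triple
      chart r z = r , 1# , z

      Z∞ : Triple
      Z∞ = 0# , 0# , 1#

      points-at-infinity : List Triple
      points-at-infinity = Z∞ ∷ map (chart i) elements ++ map (chart (- i)) elements

      Z∞-at-infinity : AtInfinityOn q a b Z∞
      Z∞-at-infinity = (λ (_ , _ , 1≡0) → 0≢1 (sym 1≡0)) , u²+v²≡0⇒at-infinity (solve 0 (O :* O :+ O :* O := O) refl)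
        where
        O : Polynomial 0
        O = con (ℤ.+ 0)

      chart-at-infinity : ∀ {r} → r * r ≡ - 1# → ∀ z → AtInfinityOn q a b (chart r z)
      chart-at-infinity {r} r²≡-1 z = (λ (_ , 1≡0 , _) → 0≢1 (sym 1≡0)) , u²+v²≡0⇒at-infinity (begin
        r * r + 1# * 1#     ≡⟨ cong₂ _+_ r²≡-1 (*-identityˡ 1#) ⟩
        - 1# + 1#           ≡⟨ -‿inverseˡ 1# ⟩
        0#                  ∎)
        where open ≡-Reasoning

      -i*-i≡-1 : - i * - i ≡ - 1#
      -i*-i≡-1 = trans (solve 1 (λ x → (:- x) :* (:- x) := x :* x) refl i) i*i≡-1

      chart≁Z∞ : ∀ {r z} → ¬ Proportional Z∞ (chart r z)
      chart≁Z∞ (λ′ , _ , _ , 1≡λ0 , _) = 0≢1 (sym (trans 1≡λ0 (zeroʳ λ′)))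

      Proportional-chart⇒≡ : ∀ {r r′ z z′} → Proportional (chart r z) (chart r′ z′) → r′ ≡ r × z′ ≡ z
      Proportional-chart⇒≡ {r} {r′} {z} {z′} (λ′ , _ , r′≡λr , 1≡λ1 , z′≡λz) = trans r′≡λr (λ′*x≡x r) , trans z′≡λz (λ′*x≡x z)
        where
        λ′*x≡x : ∀ x → λ′ * x ≡ x
        λ′*x≡x x = trans (cong (_* x) (sym (trans 1≡λ1 (*-identityʳ λ′)))) (*-identityˡ x)

      v≡0⇒∼Z∞ : ∀ {u v w} → NonZeroTriple (u , v , w) → u * u + v * v ≡ 0# → v ≡ 0# → Proportional (u , v , w) Z∞
      v≡0⇒∼Z∞ {u} {v} {w} nonzero u²+v²≡0 v≡0 =
        w ⁻¹ , x≢0⇒x⁻¹≢0 w≢0 , sym (trans (cong (w ⁻¹ *_) u≡0) (zeroʳ _)) , sym (trans (cong (w ⁻¹ *_) v≡0) (zeroʳ _)) , sym (x⁻¹*x≡1 w≢0)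
        where
        u≡0 : u ≡ 0#
        u≡0 = u*u+v*v≡0⇒v≡0⇒u≡0 u²+v²≡0 v≡0
        w≢0 : w ≢ 0#
        w≢0 w≡0 = nonzero (u≡0 , v≡0 , w≡0)

      length-points-at-infinity : length points-at-infinity ≡ 2 ℕ.* q ℕ.^ 2 ℕ.+ 1
      length-points-at-infinity = begin
        suc (length (map (chart i) elements ++ map (chart (- i)) elements))
          ≡⟨ cong suc (List.length-++ (map (chart i) elements)) ⟩
        suc (length (map (chart i) elements) ℕ.+ length (map (chart (- i)) elements))
          ≡⟨ cong₂ (λ m n → suc (m ℕ.+ n)) (List.length-map (chart i) elements) (List.length-map (chart (- i)) elements) ⟩
        suc (length elements ℕ.+ length elements)
          ≡⟨ cong (λ m → suc (m ℕ.+ m)) (trans length-elements |F|≡q²) ⟩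
        suc (q ℕ.^ 2 ℕ.+ q ℕ.^ 2)
          ≡⟨ lemma (q ℕ.^ 2) ⟩
        2 ℕ.* q ℕ.^ 2 ℕ.+ 1
          ∎
        where
        lemma : ∀ m → suc (m ℕ.+ m) ≡ 2 ℕ.* m ℕ.+ 1
        lemma = solve-∀

      points-at-infinity-on-surface : All (AtInfinityOn q a b) points-at-infinity
      points-at-infinity-on-surface = Z∞-at-infinity ∷ All.++⁺
        (All.map⁺ (All.universal (chart-at-infinity i*i≡-1) elements))
        (All.map⁺ (All.universal (chart-at-infinity -i*-i≡-1) elements))

      points-at-infinity-distinct : AllPairs (λ s t → ¬ Proportional s t) points-at-infinity
      points-at-infinity-distinct =
          All.++⁺ (All.map⁺ (All.universal (λ _ → chart≁Z∞) elements)) (All.map⁺ (All.universal (λ _ → chart≁Z∞) elements))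
        ∷ AllPairs.++⁺ (AllPairs.map⁺ (AllPairs.map distinct-z elements-unique))
                       (AllPairs.map⁺ (AllPairs.map distinct-z elements-unique))
                       (All.map⁺ (All.universal (λ _ → All.map⁺ (All.universal (λ _ → i-vs--i) elements)) elements))
        where
        distinct-z : ∀ {r z z′} → z ≢ z′ → ¬ Proportional (chart r z) (chart r z′)
        distinct-z z≢z′ prop = z≢z′ (sym (proj₂ (Proportional-chart⇒≡ prop)))
        i-vs--i : ∀ {z z′} → ¬ Proportional (chart i z) (chart (- i) z′)
        i-vs--i prop = i≢-i (sym (proj₁ (Proportional-chart⇒≡ prop)))

      points-at-infinity-complete : a ≢ 0# → ∀ t → AtInfinityOn q a b t → Any (Proportional t) points-at-infinity
      points-at-infinity-complete a≢0 (u , v , w) (nonzero , on) with v ≟ 0#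
      ... | yes v≡0 = here (v≡0⇒∼Z∞ nonzero (at-infinity⇒u²+v²≡0 a≢0 on) v≡0)
      ... | no v≢0 = there (in-charts (r*r≡-1⇒r≡±i (u*u+v*v≡0⇒[u/v]²≡-1 v≢0 (at-infinity⇒u²+v²≡0 a≢0 on))))
        where
        proportional : ∀ {r} → v ⁻¹ * u ≡ r → Proportional (u , v , w) (chart r (v ⁻¹ * w))
        proportional u/v≡r = v ⁻¹ , x≢0⇒x⁻¹≢0 v≢0 , sym u/v≡r , sym (x⁻¹*x≡1 v≢0) , refl
        in-charts : v ⁻¹ * u ≡ i ⊎ v ⁻¹ * u ≡ - i →
                    Any (Proportional (u , v , w)) (map (chart i) elements ++ map (chart (- i)) elements)
        in-charts (inj₁ u/v≡i) = lose (∈-++⁺ˡ (∈-map⁺ (chart i) (∈-elements (v ⁻¹ * w)))) (proportional u/v≡i)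
        in-charts (inj₂ u/v≡-i) = lose (∈-++⁺ʳ (map (chart i) elements) (∈-map⁺ (chart (- i)) (∈-elements (v ⁻¹ * w))))
                                       (proportional u/v≡-i)

      points-at-infinity-count : a ≢ 0# → ProjCount (AtInfinityOn q a b) (2 ℕ.* q ℕ.^ 2 ℕ.+ 1)
      points-at-infinity-count a≢0 = points-at-infinity , length-points-at-infinity , points-at-infinity-on-surface
                                   , points-at-infinity-distinct , points-at-infinity-complete a≢0

      Q-on-isotropic-spread-point : ∀ c {U V} → Decomp q ε U (c 0F) (c 1F) → Decomp q ε V (c 2F) (c 3F) →
                                    U * U + V * V ≡ 0# → Q (infPoint c) ≡ - b1 * (U * U ^ q + V * V ^ q)
      Q-on-isotropic-spread-point c {U} {V} (c₀∈ , c₁∈ , U≡) (c₂∈ , c₃∈ , V≡) U²+V²≡0 = begin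
        Q (infPoint c)
          ≡⟨ solve 9 (λ c₀ c₁ c₂ c₃ c₅ δ a0 a1 b1 →
               Q′ᴾ δ a0 a1 b1 (con (ℤ.+ 0)) c₀ c₁ c₂ c₃ c₅
               := a0 :* (con (ℤ.+ 2) :* (c₀ :* c₁ :+ c₂ :* c₃))
                  :+ a1 :* (c₀ :* c₀ :+ δ :* (c₁ :* c₁) :+ c₂ :* c₂ :+ δ :* (c₃ :* c₃))
                  :- b1 :* (c₀ :* c₀ :- δ :* (c₁ :* c₁) :+ c₂ :* c₂ :- δ :* (c₃ :* c₃)))
             refl c₀ c₁ c₂ c₃ (c 5F) δ a0 a1 b1 ⟩
        a0 * B + a1 * A - b1 * N        ≡⟨ cong₂ (λ s t → a0 * s + a1 * t - b1 * N) B≡0 A≡0 ⟩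
        a0 * 0# + a1 * 0# - b1 * N      ≡⟨ solve 4 (λ a0 a1 b1 n → a0 :* O :+ a1 :* O :- b1 :* n := :- b1 :* n) refl a0 a1 b1 N ⟩
        - b1 * N                        ≡⟨ cong (- b1 *_) (sum-of-norms c₀∈ c₁∈ c₂∈ c₃∈) ⟨
        - b1 * ((c₀ + ε * c₁) * (c₀ + ε * c₁) ^ q + (c₂ + ε * c₃) * (c₂ + ε * c₃) ^ q)
                                        ≡⟨ cong₂ (λ s t → - b1 * (s * s ^ q + t * t ^ q)) U≡ V≡ ⟨
        - b1 * (U * U ^ q + V * V ^ q)  ∎
        where
        open ≡-Reasoning
        O : Polynomial 4
        O = con (ℤ.+ 0)
        c₀ c₁ c₂ c₃ A B N : Carrier
        c₀ = c 0F ; c₁ = c 1F ; c₂ = c 2F ; c₃ = c 3F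
        A = c₀ * c₀ + δ * (c₁ * c₁) + c₂ * c₂ + δ * (c₃ * c₃)
        B = 2# * (c₀ * c₁ + c₂ * c₃)
        N = c₀ * c₀ - δ * (c₁ * c₁) + c₂ * c₂ - δ * (c₃ * c₃)
        A+εB≡0 : A + ε * B ≡ 0#
        A+εB≡0 = trans (sym (sum-of-squares c₀ c₁ c₂ c₃)) (trans (cong₂ (λ s t → s * s + t * t) (sym U≡) (sym V≡)) U²+V²≡0)
        A∈ : InFq q A
        A∈ = InFq-+ (InFq-+ (InFq-+ (InFq-* c₀∈ c₀∈) (InFq-* InFq-δ (InFq-* c₁∈ c₁∈))) (InFq-* c₂∈ c₂∈)) (InFq-* InFq-δ (InFq-* c₃∈ c₃∈))
        B∈ : InFq q B
        B∈ = InFq-* InFq-2 (InFq-+ (InFq-* c₀∈ c₁∈) (InFq-* c₂∈ c₃∈))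
        A≡0 : A ≡ 0#
        A≡0 = proj₁ (A+εB≡0⇒A≡0∧B≡0 A∈ B∈ A+εB≡0)
        B≡0 : B ≡ 0#
        B≡0 = proj₂ (A+εB≡0⇒A≡0∧B≡0 A∈ B∈ A+εB≡0)

      q%4≡1⇒spread-lines-in-B′ : q % 4 ≡ 1 → a ≢ 0# → ∀ t → AtInfinityOn q a b t → SpreadLineIn q ε Q t
      q%4≡1⇒spread-lines-in-B′ q%4≡1 a≢0 (u , v , w) (_ , on) l _ c lu≡ lv≡ _ = begin
        Q (infPoint c)                                          ≡⟨ Q-on-isotropic-spread-point c lu≡ lv≡ isotropic ⟩
        - b1 * ((l * u) * (l * u) ^ q + (l * v) * (l * v) ^ q)  ≡⟨ cong (- b1 *_) (q%4≡1⇒u*uᵠ+v*vᵠ≡0 q%4≡1 isotropic) ⟩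
        - b1 * 0#                                               ≡⟨ zeroʳ _ ⟩
        0#                                                      ∎
        where
        open ≡-Reasoning
        isotropic = isotropic-scaled l (at-infinity⇒u²+v²≡0 a≢0 on)

      b∉Fq⇒b1≢0 : ¬ InFq q b → b1 ≢ 0#
      b∉Fq⇒b1≢0 b∉Fq b1≡0 = b∉Fq (subst (InFq q) (sym b≡b0) b0∈)
        where
        b≡b0 : b ≡ b0
        b≡b0 = trans (cong (λ z → b0 + ε * z) b1≡0) (trans (cong (b0 +_) (zeroʳ ε)) (+-identityʳ b0))

      Z∞-spread-line-in-B′ : SpreadLineIn q ε Q Z∞
      Z∞-spread-line-in-B′ l _ c l0≡ l0≡′ _ = begin
        Q (infPoint c)                                          ≡⟨ Q-on-isotropic-spread-point c l0≡ l0≡′ (isotropic-scaled l (solve 0 (O :* O :+ O :* O := O) refl)) ⟩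
        - b1 * ((l * 0#) * (l * 0#) ^ q + (l * 0#) * (l * 0#) ^ q) ≡⟨ cong (λ z → - b1 * (z * z ^ q + z * z ^ q)) (zeroʳ l) ⟩
        - b1 * (0# * 0# ^ q + 0# * 0# ^ q)                      ≡⟨ solve 2 (λ b z → :- b :* (O :* z :+ O :* z) := O) refl b1 (0# ^ q) ⟩
        0#                                                      ∎
        where
        open ≡-Reasoning
        O : ∀ {k} → Polynomial k
        O = con (ℤ.+ 0)

      -- The point (u/v, 1, w/v) of the spread line has u/v = εs with s ∈ F_q, and Q = −2 b1 there.
      q%4≡3⇒spread-line∉B′ : q % 4 ≡ 3 → b1 ≢ 0# → ∀ {u v w} → v ≢ 0# → u * u + v * v ≡ 0# → ¬ SpreadLineIn q ε Q (u , v , w)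
      q%4≡3⇒spread-line∉B′ q%4≡3 b1≢0 {u} {v} {w} v≢0 u²+v²≡0 in-B′ =
        b1≢0 (2*x≡0⇒x≡0 (-x≡0⇒x≡0 (begin
            - (2# * b1)                                          ≡⟨ solve 1 (λ b → :- (con (ℤ.+ 2) :* b) := :- b :* (con (ℤ.+ 1) :+ con (ℤ.+ 1))) refl b1 ⟩
            - b1 * (1# + 1#)                                     ≡⟨ cong₂ (λ x y → - b1 * (x + y)) norm-u/v≡1 norm-v/v≡1 ⟨
            - b1 * (u/v * u/v ^ q + v/v * v/v ^ q)               ≡⟨ Q-on-isotropic-spread-point c u/v≡ v/v≡ (isotropic-scaled (v ⁻¹) u²+v²≡0) ⟨
            Q (infPoint c)                                       ≡⟨ in-B′ (v ⁻¹) (x≢0⇒x⁻¹≢0 v≢0) c u/v≡ v/v≡ w/v≡ ⟩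
            0#                                                   ∎)))
        where
        open ≡-Reasoning
        u/v v/v : Carrier
        u/v = v ⁻¹ * u
        v/v = v ⁻¹ * v
        [u/v]²≡-1 : u/v * u/v ≡ - 1#
        [u/v]²≡-1 = u*u+v*v≡0⇒[u/v]²≡-1 v≢0 u²+v²≡0
        εs : Σ Carrier λ s → InFq q s × u/v ≡ ε * s
        εs = q%4≡3⇒√-1∈εFq q%4≡3 [u/v]²≡-1
        s : Carrier
        s = proj₁ εs
        s∈ : InFq q s
        s∈ = proj₁ (proj₂ εs)
        u/v≡εs : u/v ≡ ε * s
        u/v≡εs = proj₂ (proj₂ εs)
        w/v : Σ Carrier λ d₀ → Σ Carrier λ d₁ → Decomp q ε (v ⁻¹ * w) d₀ d₁
        w/v = decompose (v ⁻¹ * w)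
        c : Vecₙ 6
        c = λ where 0F → 0# ; 1F → s ; 2F → 1# ; 3F → 0# ; 4F → proj₁ w/v ; 5F → proj₁ (proj₂ w/v)
        u/v≡ : Decomp q ε u/v 0# s
        u/v≡ = InFq-0 , s∈ , trans u/v≡εs (sym (+-identityˡ _))
        v/v≡ : Decomp q ε v/v 1# 0#
        v/v≡ = InFq-1 , InFq-0 , trans (x⁻¹*x≡1 v≢0) (solve 1 (λ e → con (ℤ.+ 1) := con (ℤ.+ 1) :+ e :* con (ℤ.+ 0)) refl ε)
        w/v≡ : Decomp q ε (v ⁻¹ * w) (proj₁ w/v) (proj₁ (proj₂ w/v))
        w/v≡ = proj₂ (proj₂ w/v)
        norm-u/v≡1 : u/v * u/v ^ q ≡ 1#
        norm-u/v≡1 = begin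
          u/v * u/v ^ q           ≡⟨ cong (λ x → u/v * x ^ q) u/v≡εs ⟩
          u/v * (ε * s) ^ q       ≡⟨ cong (u/v *_) (^-distrib-* ε s q) ⟩
          u/v * (ε ^ q * s ^ q)   ≡⟨ cong₂ (λ x y → u/v * (x * y)) ε^q≡-ε s∈ ⟩
          u/v * (- ε * s)         ≡⟨ cong (u/v *_) (-‿distribˡ-* ε s) ⟨
          u/v * - (ε * s)         ≡⟨ cong (λ x → u/v * - x) u/v≡εs ⟨
          u/v * - u/v             ≡⟨ solve 1 (λ x → x :* (:- x) := :- (x :* x)) refl u/v ⟩
          - (u/v * u/v)           ≡⟨ cong -_ [u/v]²≡-1 ⟩
          - - 1#                  ≡⟨ -‿involutive 1# ⟩
          1#                      ∎
        norm-v/v≡1 : v/v * v/v ^ q ≡ 1#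
        norm-v/v≡1 = trans (cong (λ x → x * x ^ q) (x⁻¹*x≡1 v≢0)) (trans (*-identityˡ _) (1^n≡1 q))

      q%4≡3⇒one-spread-line-in-B′ : q % 4 ≡ 3 → a ≢ 0# → b1 ≢ 0# →
                                     ProjCount (λ t → AtInfinityOn q a b t × SpreadLineIn q ε Q t) 1
      q%4≡3⇒one-spread-line-in-B′ q%4≡3 a≢0 b1≢0 =
        Z∞ ∷ [] , refl , (Z∞-at-infinity , Z∞-spread-line-in-B′) ∷ [] , [] ∷ [] , complete
        where
        complete : ∀ t → AtInfinityOn q a b t × SpreadLineIn q ε Q t → Any (Proportional t) (Z∞ ∷ [])
        complete (u , v , w) ((nonzero , on) , in-B′) with v ≟ 0#
        ... | yes v≡0 = here (v≡0⇒∼Z∞ nonzero (at-infinity⇒u²+v²≡0 a≢0 on) v≡0)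
        ... | no v≢0 = ⊥-elim (q%4≡3⇒spread-line∉B′ q%4≡3 b1≢0 v≢0 (at-infinity⇒u²+v²≡0 a≢0 on) in-B′)

theorem5p2 : (q : ℕ) → IsOddPrimePower q →
  (F : FiniteField) → FiniteField.size F ≡ q ℕ.^ 2 →
  let open FF F in
  (ε : Carrier) → ¬ InFq q ε → ε ^ q ≡ - ε →
  (a0 a1 b0 b1 : Carrier) →
  InFq q a0 → InFq q a1 → InFq q b0 → InFq q b1 →
  let δ = ε * ε
      a = a0 + ε * a1
      b = b0 + ε * b1
      Q = Q′ δ a0 a1 b1
  in
  ¬ (a ≡ 0#) → ¬ InFq q b →
  ¬ (4# * (a ^ (q ℕ.+ 1)) + ((b ^ q) - b) ^ 2 ≡ 0#) →
  -- affine points of B_{a,b} correspond to affine points of B'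
  (∀ (x : Vecₙ 6) → FqVec q 6 x →
     (SurfaceEq q a b 1# (x 0F + ε * x 1F) (x 2F + ε * x 3F) (x 4F + ε * x 5F)
        → Q (affPoint x) ≡ 0#)
     × (Q (affPoint x) ≡ 0#
        → SurfaceEq q a b 1# (x 0F + ε * x 1F) (x 2F + ε * x 3F) (x 4F + ε * x 5F)))
  -- B' is a cone with vertex V ...
  × InRadical q 7 Q V
  × (∀ y → FqVec q 7 y → InRadical q 7 Q y →
       Σ Carrier λ μ → InFq q μ × (∀ i → y i ≡ μ * V i))
  -- ... whose base is a non-degenerate hyperbolic quadric of PG(5,q)
  × HyperbolicPG5 q (Qbase δ a0 a1 b1)
  -- B_{a,b} ∩ {J = 0} consists of 2q^2+1 points (spread lines r_P)
  × ProjCount (AtInfinityOn q a b) (2 ℕ.* q ℕ.^ 2 ℕ.+ 1)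
  -- q ≡ 1 (mod 4): all these lines r_P are contained in B'
  × (q ℕ.% 4 ≡ 1 → ∀ t → AtInfinityOn q a b t → SpreadLineIn q ε Q t)
  -- q ≡ 3 (mod 4): exactly one of them is contained in B'
  × (q ℕ.% 4 ≡ 3 →
       ProjCount (λ t → AtInfinityOn q a b t × SpreadLineIn q ε Q t) 1)
theorem5p2 q (p , n , p-prime , 1≤n , q≡pⁿ , q%2≡1) F |F|≡q² ε ε∉Fq ε^q≡-ε a0 a1 b0 b1 a0∈ a1∈ b0∈ b1∈ a≢0 b∉Fq disc≢0 =
    affine-correspondence
  , V-InRadical
  , radical⊆⟨V⟩ D≢0
  , base-hyperbolic D≢0
  , points-at-infinity-count a≢0
  , (λ q%4≡1 → q%4≡1⇒spread-lines-in-B′ q%4≡1 a≢0)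
  , (λ q%4≡3 → q%4≡3⇒one-spread-line-in-B′ q%4≡3 a≢0 (b∉Fq⇒b1≢0 b∉Fq))
  where
  open Subfield p-prime 1≤n q≡pⁿ q%2≡1 F |F|≡q²
  open QuadraticExtension ε ε∉Fq ε^q≡-ε
  open Surface a0∈ a1∈ b0∈ b1∈
  D≢0 : D ≢ 0#
  D≢0 = disc≢0⇒D≢0 disc≢0
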